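{- Let $\mu,\nu,q\in\mathbb{C}$, $r\in\mathbb{N}$, and let $X,Y$ satisfy $XY-qYX=\mu I+\nu Y$. Define the $q$-deformed Ore-Scherk numbers of degree $r$, $S^{(r)}_{\mu,\nu;q}(n;j,k)$, as the coefficient of $Y^jX^k$ in the normal ordered expansion of $(Y^rX)^n$. Then for all $n\ge0$ and $0\le k\le j$, $$S^{(r)}_{\mu,\nu;q}(n;j,k)=m_{rn-j,\,j-(r-1)n-k}(J_{n,r};q),$$ where $m_{a,b}(J_{n,r};q):=0$ if $a<0$ or $b<0$.
   Context: The monomials $Y^jX^k$ form a basis of this algebra. The $r$-jump board $J_{n,r}$ is the Ferrers board of the word $(Y^rX)^n$: top-aligned columns of heights $r(n-1),r(n-2),\dots,r,0$ from left to right. "Above" means in a higher row. For a Ferrers board $B$ and $a,b\ge0$, $\mathcal{M}_{a,b}(B)$ is the set of placements of $a$ rooks and $b$ files in distinct cells such that no two rooks share a row or column, no two files share a column, no file and rook share a column, and no file lies in the same row as a rook and to its left. A cell containing nothing is cancelled if it lies above a rook in its column, to the left of a rook in its row, or above a file in its column; otherwise it is an empty box. $m_{a,b}(B;q)=\mu^a\nu^b\sum_{\phi\in\mathcal{M}_{a,b}(B)}q^{\#\text{empty boxes of }\phi}$. -}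

module Defs where

open import Level using (Level)
open import Data.Bool using (Bool; true; false; _∧_; _∨_; not; if_then_else_)
open import Data.Nat using (ℕ; zero; suc; _∸_; _≡ᵇ_; _<ᵇ_)
open import Data.Nat as ℕ using ()
open import Data.Integer using (ℤ; +_; -[1+_])
open import Data.List using (List; []; _∷_; _++_; map; concatMap; replicate; concat; upTo; foldr; zip; length)
open import Data.List as L using ()
open import Data.Bool.ListAction using (any)
open import Relation.Nullary.Decidable.Core using (T?)

filterᵇ : {A : Set} → (A → Bool) → List A → List A
filterᵇ p = L.filter (λ x → T? (p x))
open import Data.Product using (_×_; _,_; proj₁; proj₂)
open import Algebra.Bundles using (CommutativeRing)

data Letter : Set where
  X Y : Letter

wordYrX : ℕ → ℕ → List Letter
wordYrX n r = concat (replicate n (replicate r Y ++ (X ∷ [])))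

-- cell = (column index from the left, row index from the top); both 0-based.
-- A Ferrers board is given by its list of top-aligned column heights.
Cell : Set
Cell = ℕ × ℕ

col row : Cell → ℕ
col = proj₁
row = proj₂

cellsFrom : ℕ → List ℕ → List Cell
cellsFrom c []       = []
cellsFrom c (h ∷ hs) = map (λ i → (c , i)) (upTo h) ++ cellsFrom (suc c) hs

cells : List ℕ → List Cell
cells = cellsFrom 0

jumpBoard : ℕ → ℕ → List ℕ
jumpBoard n r = map (λ i → r ℕ.* (n ∸ suc i)) (upTo n)

data Content : Set where
  nothing rook file : Content

isRook isFile isNothing : Content → Bool
isRook rook = true
isRook _    = false
isFile file = true
isFile _    = false
isNothing nothing = true
isNothing _       = false

labellings : ℕ → List (List Content)
labellings zero    = [] ∷ []
labellings (suc N) =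
  concatMap (λ l → (nothing ∷ l) ∷ (rook ∷ l) ∷ (file ∷ l) ∷ []) (labellings N)

Placement : Set
Placement = List (Cell × Content)

placements : List ℕ → List Placement
placements B = map (zip (cells B)) (labellings (length (cells B)))

sameCell : Cell → Cell → Bool
sameCell x y = (col x ≡ᵇ col y) ∧ (row x ≡ᵇ row y)

conflict : Cell × Content → Cell × Content → Bool
conflict (x , cx) (y , cy) =
     (isRook cx ∧ isRook cy ∧ not (sameCell x y) ∧ ((row x ≡ᵇ row y) ∨ (col x ≡ᵇ col y)))
  ∨  (isFile cx ∧ isFile cy ∧ not (sameCell x y) ∧ (col x ≡ᵇ col y))
  ∨  (isFile cx ∧ isRook cy ∧ (col x ≡ᵇ col y))
  ∨  (isFile cx ∧ isRook cy ∧ (row x ≡ᵇ row y) ∧ (col x <ᵇ col y))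

valid : Placement → Bool
valid P = not (any (λ x → any (conflict x) P) P)

count : (Content → Bool) → Placement → ℕ
count p P = length (filterᵇ (λ x → p (proj₂ x)) P)

-- "above" = in a higher row = smaller row index (rows counted from the top)
cancelledBy : Cell → Cell × Content → Bool
cancelledBy e (y , cy) =
     (isRook cy ∧ (col e ≡ᵇ col y) ∧ (row e <ᵇ row y))
  ∨  (isRook cy ∧ (row e ≡ᵇ row y) ∧ (col e <ᵇ col y))
  ∨  (isFile cy ∧ (col e ≡ᵇ col y) ∧ (row e <ᵇ row y))

isEmptyBox : Placement → Cell × Content → Bool
isEmptyBox P (e , ce) = isNothing ce ∧ not (any (cancelledBy e) P)

emptyBoxes : Placement → ℕ
emptyBoxes P = length (filterᵇ (isEmptyBox P) P)

M : ℕ → ℕ → List ℕ → List Placement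
M a b B = filterᵇ (λ P → valid P ∧ (count isRook P ≡ᵇ a) ∧ (count isFile P ≡ᵇ b)) (placements B)

module WithRing {c ℓ : Level} (R : CommutativeRing c ℓ) where
  open CommutativeRing R

  pow : Carrier → ℕ → Carrier
  pow x zero    = 1#
  pow x (suc k) = x * pow x k

  -- a normal ordered expression: formal sum of terms  coeff · Y^j X^k
  Term : Set c
  Term = Carrier × ℕ × ℕ

  module Relation (μ ν q : Carrier) where
    -- normal ordered form of X Y^j, using XY = qYX + μ + νY:
    -- X Y^(j+1) = (qYX + μ + νY) Y^j = q Y (X Y^j) + μ Y^j + ν Y^(j+1)
    XYpow : ℕ → List Term
    XYpow zero    = (1# , 0 , 1) ∷ []
    XYpow (suc j) =
      map (λ { (d , a , b) → (q * d , suc a , b) }) (XYpow j)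
      ++ (μ , j , 0) ∷ (ν , suc j , 0) ∷ []

    normal : List Letter → List Term
    normal []      = (1# , 0 , 0) ∷ []
    normal (Y ∷ w) = map (λ { (d , a , b) → (d , suc a , b) }) (normal w)
    normal (X ∷ w) =
      concatMap (λ { (d , j , k) →
        map (λ { (e , a , b) → (e * d , a , b ℕ.+ k) }) (XYpow j) }) (normal w)

    coeff : ℕ → ℕ → List Term → Carrier
    coeff j k = foldr (λ { (d , a , b) acc →
      if (a ≡ᵇ j) ∧ (b ≡ᵇ k) then d + acc else acc }) 0#

    S : ℕ → ℕ → ℕ → ℕ → Carrier
    S r n j k = coeff j k (normal (wordYrX n r))

    m : ℕ → ℕ → List ℕ → Carrier
    m a b B = pow μ a * pow ν b * foldr (λ P acc → pow q (emptyBoxes P) + acc) 0# (M a b B)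

    mℤ : ℤ → ℤ → List ℕ → Carrier
    mℤ (+ a)    (+ b)    B = m a b B
    mℤ (+ a)    -[1+ _ ] B = 0#
    mℤ -[1+ _ ] _        B = 0#

module Submission where

-- Both sides satisfy the same recursion in n, and agree for n = 0.
--
-- Normal ordering: (Y^r X)^(n+1) = Y^r X (Y^r X)^n and X Y^j = q^j Y^j X + μ [j]_q Y^(j-1) + ν [j]_q Y^j
-- give S(n+1; r+j, k) = q^j S(n; j, k-1) + μ [j+1]_q S(n; j+1, k) + ν [j]_q S(n; j, k),
-- and S(n+1; j, k) = 0 for j < r.
--
-- Rook numbers: J_(n+1) is J_n with a column of height h = rn added on the left. In a placement
-- this column carries at most one piece, in a row containing no rook of the rest, and its empty
-- boxes are the rook-free rows below that piece (all rook-free rows if it is empty). A valid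
-- placement of a rooks on J_n leaves h - a rook-free rows, so
--   m_(a,b)(J_(n+1)) = q^(h-a) m_(a,b)(J_n) + μ [h-a+1]_q m_(a-1,b)(J_n) + ν [h-a]_q m_(a,b-1)(J_n),
-- which is the recursion of S under a = rn - j, b = j - (r-1)n - k. The terms that fall outside
-- the range of the theorem vanish because there are at most n pieces on J_n and at most rn rooks
-- on J_(n+1).

open import Defs
open import Level using (Level)
open import Algebra.Bundles using (CommutativeRing)

module Lists where

  open import Algebra.Bundles using (CommutativeMonoid)
  open import Data.Bool using (Bool; true; false; _∨_; not)
  open import Data.Bool.Properties using (∨-assoc; ∨-commutativeMonoid)
  open import Data.Bool.ListAction using (any)
  open import Data.List using (List; []; _∷_; _++_; map; length)
  open import Data.List.Membership.Propositional using (_∈_)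
  open import Data.List.Relation.Unary.Any using (here; there)
  open import Data.List.Relation.Unary.All as All using (All; []; _∷_)
  open import Data.List.Relation.Unary.AllPairs using (AllPairs; _∷_)
  open import Data.Nat using (ℕ; zero; suc; _+_; _<_; _≡ᵇ_; _<ᵇ_; s≤s)
  open import Function using (_∘_)
  open import Relation.Binary.PropositionalEquality using (_≡_; refl; sym; trans; cong; cong₂)
  open import Algebra.Properties.CommutativeSemigroup
    (CommutativeMonoid.commutativeSemigroup ∨-commutativeMonoid) using () renaming (interchange to ∨-interchange)

  private
    variable
      A B : Set

  any-++ : (p : A → Bool) (xs ys : List A) → any p (xs ++ ys) ≡ (any p xs ∨ any p ys)
  any-++ p []       ys = refl
  any-++ p (x ∷ xs) ys = trans (cong (p x ∨_) (any-++ p xs ys)) (sym (∨-assoc (p x) _ _))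

  any-map : (p : B → Bool) (f : A → B) (xs : List A) → any p (map f xs) ≡ any (p ∘ f) xs
  any-map p f []       = refl
  any-map p f (x ∷ xs) = cong (p (f x) ∨_) (any-map p f xs)

  any-cong : {p p′ : A → Bool} → (∀ x → p x ≡ p′ x) → (xs : List A) → any p xs ≡ any p′ xs
  any-cong p≗p′ []       = refl
  any-cong p≗p′ (x ∷ xs) = cong₂ _∨_ (p≗p′ x) (any-cong p≗p′ xs)

  any-false : {p : A → Bool} → (∀ x → p x ≡ false) → (xs : List A) → any p xs ≡ false
  any-false p≗false []       = refl
  any-false p≗false (x ∷ xs) = cong₂ _∨_ (p≗false x) (any-false p≗false xs)

  any-∨ : (p p′ : A → Bool) (xs : List A) → any (λ x → p x ∨ p′ x) xs ≡ (any p xs ∨ any p′ xs)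
  any-∨ p p′ []       = refl
  any-∨ p p′ (x ∷ xs) = trans (cong ((p x ∨ p′ x) ∨_) (any-∨ p p′ xs)) (∨-interchange (p x) (p′ x) _ _)

  boolToℕ : Bool → ℕ
  boolToℕ true  = 1
  boolToℕ false = 0

  length-filterᵇ-∷ : (p : A → Bool) (x : A) (xs : List A) →
    length (filterᵇ p (x ∷ xs)) ≡ boolToℕ (p x) + length (filterᵇ p xs)
  length-filterᵇ-∷ p x xs with p x
  ... | true  = refl
  ... | false = refl

  length-filterᵇ-map : (p : B → Bool) (f : A → B) (xs : List A) →
    length (filterᵇ p (map f xs)) ≡ length (filterᵇ (p ∘ f) xs)
  length-filterᵇ-map p f []       = refl
  length-filterᵇ-map p f (x ∷ xs) = trans (length-filterᵇ-∷ p (f x) (map f xs))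
    (trans (cong (boolToℕ (p (f x)) +_) (length-filterᵇ-map p f xs)) (sym (length-filterᵇ-∷ (p ∘ f) x xs)))

  length-filterᵇ-cong : {p p′ : A → Bool} (xs : List A) → All (λ x → p x ≡ p′ x) xs →
    length (filterᵇ p xs) ≡ length (filterᵇ p′ xs)
  length-filterᵇ-cong             []       []           = refl
  length-filterᵇ-cong {p = p} {p′} (x ∷ xs) (px≡p′x ∷ eqs) = trans (length-filterᵇ-∷ p x xs)
    (trans (cong₂ _+_ (cong boolToℕ px≡p′x) (length-filterᵇ-cong xs eqs)) (sym (length-filterᵇ-∷ p′ x xs)))

  ≡ᵇ-refl : ∀ n → (n ≡ᵇ n) ≡ true
  ≡ᵇ-refl zero    = refl
  ≡ᵇ-refl (suc n) = ≡ᵇ-refl n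

  ≡ᵇ-sym : ∀ m n → (m ≡ᵇ n) ≡ (n ≡ᵇ m)
  ≡ᵇ-sym zero    zero    = refl
  ≡ᵇ-sym zero    (suc n) = refl
  ≡ᵇ-sym (suc m) zero    = refl
  ≡ᵇ-sym (suc m) (suc n) = ≡ᵇ-sym m n

  <⇒≢ᵇ : ∀ {m n} → m < n → (m ≡ᵇ n) ≡ false
  <⇒≢ᵇ {zero}  {suc n} _       = refl
  <⇒≢ᵇ {suc m} {suc n} (s≤s p) = <⇒≢ᵇ p

  >⇒≢ᵇ : ∀ {m n} → n < m → (m ≡ᵇ n) ≡ false
  >⇒≢ᵇ {m} {n} n<m = trans (≡ᵇ-sym m n) (<⇒≢ᵇ n<m)

  <⇒<ᵇ≡true : ∀ {m n} → m < n → (m <ᵇ n) ≡ true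
  <⇒<ᵇ≡true {zero}  {suc n} _       = refl
  <⇒<ᵇ≡true {suc m} {suc n} (s≤s p) = <⇒<ᵇ≡true p

  >⇒<ᵇ≡false : ∀ {m n} → n < m → (m <ᵇ n) ≡ false
  >⇒<ᵇ≡false {suc m} {zero}  _       = refl
  >⇒<ᵇ≡false {suc m} {suc n} (s≤s p) = >⇒<ᵇ≡false p

  length-filterᵇ-remove : ∀ (taken : ℕ → Bool) {b is} → AllPairs _<_ is → b ∈ is → taken b ≡ false →
    suc (length (filterᵇ (λ i → not ((i ≡ᵇ b) ∨ taken i)) is)) ≡ length (filterᵇ (not ∘ taken) is)
  length-filterᵇ-remove taken {b} {_ ∷ is} (b<is ∷ _) (here refl) b-free rewrite ≡ᵇ-refl b =
    trans (cong suc (length-filterᵇ-cong is (All.map (λ {i} b<i → cong (λ e → not (e ∨ taken i)) (>⇒≢ᵇ b<i)) b<is)))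
          (sym (trans (length-filterᵇ-∷ (not ∘ taken) b is)
                      (cong (λ e → boolToℕ (not e) + length (filterᵇ (not ∘ taken) is)) b-free)))
  length-filterᵇ-remove taken {_} {i ∷ _} (i<is ∷ sorted) (there b∈is) b-free
    rewrite <⇒≢ᵇ (All.lookup i<is b∈is) with taken i
  ... | true  = length-filterᵇ-remove taken sorted b∈is b-free
  ... | false = cong suc (length-filterᵇ-remove taken sorted b∈is b-free)

open Lists

module Boards where

  open import Data.Bool using (Bool; true; false; _∧_; _∨_; not)
  open import Data.Bool.Properties
    using (∨-identityʳ; ∧-identityʳ; ∧-zeroʳ; ∨-zeroʳ; ∨-conicalˡ; ∨-conicalʳ; ∧-conicalˡ; ∧-conicalʳ; not-injective)
  open import Data.Bool.ListAction using (any)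
  open import Data.List using (List; []; _∷_; _++_; map; length; upTo)
  open import Data.List.Properties using (length-map; map-applyUpTo; filter-all; map-++; map-∘; length-upTo)
  open import Data.List.Membership.Propositional using (_∈_)
  open import Data.List.Membership.Propositional.Properties using (∈-upTo⁺)
  open import Data.List.Relation.Unary.All as All using (All; []; _∷_)
  import Data.List.Relation.Unary.All.Properties as All
  open import Data.List.Relation.Unary.AllPairs as AllPairs using (AllPairs; []; _∷_)
  import Data.List.Relation.Unary.AllPairs.Properties as AllPairs
  open import Data.Nat using (ℕ; suc; _+_; _*_; _∸_; _≥_; _<_; _≤_; _≡ᵇ_; s≤s)
  open import Data.Nat.Properties
    using (m∸n≤m; ≤-refl; *-monoʳ-≤; ∸-monoʳ-≤; +-assoc; +-suc; +-identityʳ; <⇒≤; ≤-trans; n≤1+n; <-≤-trans; m+n∸n≡m)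
  open import Data.Product using (_×_; _,_; proj₁; proj₂; map₁)
  open import Function using (_∘_; _on_; id)
  open import Relation.Binary.PropositionalEquality using (_≡_; refl; sym; trans; cong; cong₂; subst; module ≡-Reasoning)

  shiftCell : Cell → Cell
  shiftCell (c , i) = (suc c , i)

  shift : Placement → Placement
  shift = map (map₁ shiftCell)

  blank : List Cell → Placement
  blank = map (_, nothing)

  column : List ℕ → List Cell
  column = map (0 ,_)

  hasPiece : Placement → Bool
  hasPiece = any (not ∘ isNothing ∘ proj₂)

  rookInRow : Placement → ℕ → Bool
  rookInRow P i = any (λ y → isRook (proj₂ y) ∧ (i ≡ᵇ row (proj₁ y))) P

  freeRows : Placement → List ℕ → ℕ
  freeRows P is = length (filterᵇ (not ∘ rookInRow P) is)

  clash : Cell × Content → Placement → Bool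
  clash x = any (λ y → conflict x y ∨ conflict y x)

  data IsPiece : Content → Set where
    rook : IsPiece rook
    file : IsPiece file

  valid-∷ : ∀ x P → valid (x ∷ P) ≡ (not (conflict x x ∨ clash x P) ∧ valid P)
  valid-∷ x P = begin
    not ((conflict x x ∨ any (conflict x) P) ∨ any (λ y → conflict y x ∨ any (conflict y) P) P)
      ≡⟨ cong (λ b → not ((conflict x x ∨ any (conflict x) P) ∨ b)) (any-∨ _ _ P) ⟩
    not ((conflict x x ∨ any (conflict x) P) ∨ (any (λ y → conflict y x) P ∨ any (λ y → any (conflict y) P) P))
      ≡⟨ split (conflict x x) _ _ _ ⟩
    not (conflict x x ∨ (any (conflict x) P ∨ any (λ y → conflict y x) P)) ∧ valid P
      ≡⟨ cong (λ b → not (conflict x x ∨ b) ∧ valid P) (sym (any-∨ (conflict x) (λ y → conflict y x) P)) ⟩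
    not (conflict x x ∨ clash x P) ∧ valid P ∎
    where
    open ≡-Reasoning
    split : ∀ c a b d → not ((c ∨ a) ∨ (b ∨ d)) ≡ (not (c ∨ (a ∨ b)) ∧ not d)
    split true  _     _     _ = refl
    split false true  _     _ = refl
    split false false true  _ = refl
    split false false false _ = refl

  valid-∷⁻ : ∀ x P → valid (x ∷ P) ≡ true → valid P ≡ true
  valid-∷⁻ x P v = ∧-conicalʳ _ _ (trans (sym (valid-∷ x P)) v)

  valid-∷⇒no-conflict : ∀ x P → valid (x ∷ P) ≡ true → any (conflict x) P ≡ false
  valid-∷⇒no-conflict x P v = ∨-conicalˡ _ _ (trans (sym (any-∨ (conflict x) (λ y → conflict y x) P))
    (∨-conicalʳ (conflict x x) _ (not-injective (∧-conicalˡ _ _ (trans (sym (valid-∷ x P)) v)))))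

  clash⇒invalid : ∀ x P → clash x P ≡ true → valid (x ∷ P) ≡ false
  clash⇒invalid x P clash≡true
    rewrite valid-∷ x P | clash≡true | ∨-zeroʳ (conflict x x) = refl

  conflict-self : ∀ x → conflict x x ≡ false
  conflict-self ((c , i) , nothing) = refl
  conflict-self ((c , i) , rook) rewrite ≡ᵇ-refl c | ≡ᵇ-refl i = refl
  conflict-self ((c , i) , file) rewrite ≡ᵇ-refl c | ≡ᵇ-refl i = refl

  -- conflict and cancelledBy only compare coordinates, so shifting both cells leaves them unchanged
  -- definitionally.
  valid-shift : ∀ P → valid (shift P) ≡ valid P
  valid-shift P = cong not (trans (any-map _ _ P) (any-cong (λ x → any-map (conflict (map₁ shiftCell x)) _ P) P))

  count-shift : ∀ p P → count p (shift P) ≡ count p P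
  count-shift p P = length-filterᵇ-map _ _ P

  emptyBoxes-shift : ∀ P → emptyBoxes (shift P) ≡ emptyBoxes P
  emptyBoxes-shift P = trans (length-filterᵇ-map _ _ P) (length-filterᵇ-cong P (All.universal
    (λ z → cong (λ b → isNothing (proj₂ z) ∧ not b) (any-map (cancelledBy (shiftCell (proj₁ z))) _ P)) P))

  conflict-blankʳ : ∀ x d → conflict x (d , nothing) ≡ false
  conflict-blankʳ (_ , nothing) d = refl
  conflict-blankʳ (_ , rook)    d = refl
  conflict-blankʳ (_ , file)    d = refl

  clash-blank∷ : ∀ x d P → clash x ((d , nothing) ∷ P) ≡ clash x P
  clash-blank∷ x d P rewrite conflict-blankʳ x d = refl

  clash-blank-++ : ∀ x cs P → clash x (blank cs ++ P) ≡ clash x P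
  clash-blank-++ x []       P = refl
  clash-blank-++ x (c ∷ cs) P = trans (clash-blank∷ x c (blank cs ++ P)) (clash-blank-++ x cs P)

  valid-blank∷ : ∀ d P → valid ((d , nothing) ∷ P) ≡ valid P
  valid-blank∷ d P = trans (valid-∷ (d , nothing) P)
    (cong (λ b → not b ∧ valid P) (any-false (λ y → conflict-blankʳ y d) P))

  valid-blank-++ : ∀ cs P → valid (blank cs ++ P) ≡ valid P
  valid-blank-++ []       P = refl
  valid-blank-++ (c ∷ cs) P = trans (valid-blank∷ c (blank cs ++ P)) (valid-blank-++ cs P)

  count-blank-++ : ∀ p → p nothing ≡ false → ∀ cs P → count p (blank cs ++ P) ≡ count p P
  count-blank-++ p pn≡false []       P = refl
  count-blank-++ p pn≡false (c ∷ cs) P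
    rewrite length-filterᵇ-∷ (p ∘ proj₂) (c , nothing) (blank cs ++ P) | pn≡false
    = count-blank-++ p pn≡false cs P

  emptyBoxes-blank∷ : ∀ d P → emptyBoxes ((d , nothing) ∷ P) ≡ boolToℕ (not (any (cancelledBy d) P)) + emptyBoxes P
  emptyBoxes-blank∷ d P = length-filterᵇ-∷ _ (d , nothing) P

  emptyBoxes-piece∷ : ∀ x P → isNothing (proj₂ x) ≡ false → All (λ z → cancelledBy (proj₁ z) x ≡ false) P →
    emptyBoxes (x ∷ P) ≡ emptyBoxes P
  emptyBoxes-piece∷ x P x-piece x-cancels-nothing = trans (length-filterᵇ-∷ _ x P)
    (cong₂ _+_ (cong (λ b → boolToℕ (b ∧ not (any (cancelledBy (proj₁ x)) (x ∷ P)))) x-piece) (length-filterᵇ-cong P (All.map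
      (λ {z} z-unaffected → cong (λ b → isNothing (proj₂ z) ∧ not (b ∨ any (cancelledBy (proj₁ z)) P)) z-unaffected)
      x-cancels-nothing)))

  Below : ℕ → Cell → Set
  Below i x = col x ≡ 0 × i < row x

  column-below : ∀ {i is} (C : Placement) → All (i <_) is → map proj₁ C ≡ column is → All (Below i ∘ proj₁) C
  column-below {i} C i<is C-cells =
    All.map⁻ (subst (All (Below i)) (sym C-cells) (All.map⁺ (All.map (refl ,_) i<is)))

  cancelledBy-below : ∀ i C → All (Below i ∘ proj₁) C → any (cancelledBy (0 , i)) C ≡ hasPiece C
  cancelledBy-below i []                         []                  = refl
  cancelledBy-below i (((.0 , j) , nothing) ∷ C) ((refl , _)   ∷ bs) = cancelledBy-below i C bs
  cancelledBy-below i (((.0 , j) , rook)    ∷ C) ((refl , i<j) ∷ bs) rewrite <⇒<ᵇ≡true i<j = refl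
  cancelledBy-below i (((.0 , j) , file)    ∷ C) ((refl , i<j) ∷ bs) rewrite <⇒<ᵇ≡true i<j = refl

  clash-below : ∀ i {t} → IsPiece t → ∀ C → All (Below i ∘ proj₁) C → hasPiece C ≡ true →
    clash ((0 , i) , t) C ≡ true
  clash-below i p    []                         []                  ()
  clash-below i {t} p (((.0 , j) , nothing) ∷ C) ((refl , _) ∷ bs) piece =
    trans (clash-blank∷ ((0 , i) , t) (0 , j) C) (clash-below i p C bs piece)
  clash-below i rook (((.0 , j) , rook)    ∷ C) ((refl , i<j) ∷ bs) _ rewrite <⇒≢ᵇ i<j = refl
  clash-below i file (((.0 , j) , rook)    ∷ C) ((refl , _)   ∷ bs) _ = refl
  clash-below i rook (((.0 , j) , file)    ∷ C) ((refl , _)   ∷ bs) _ = refl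
  clash-below i file (((.0 , j) , file)    ∷ C) ((refl , i<j) ∷ bs) _ rewrite <⇒≢ᵇ i<j = refl

  clash-shift : ∀ i {t} → IsPiece t → ∀ P → clash ((0 , i) , t) (shift P) ≡ rookInRow P i
  clash-shift i p P = trans (any-map _ _ P) (any-cong (pointwise p) P)
    where
    pointwise : ∀ {t} → IsPiece t → ∀ y →
      (conflict ((0 , i) , t) (map₁ shiftCell y) ∨ conflict (map₁ shiftCell y) ((0 , i) , t))
        ≡ (isRook (proj₂ y) ∧ (i ≡ᵇ row (proj₁ y)))
    pointwise rook (_ , nothing) = refl
    pointwise rook ((_ , j) , rook) rewrite ≡ᵇ-sym j i with i ≡ᵇ j
    ... | true  = refl
    ... | false = refl
    pointwise rook ((_ , j) , file) rewrite ∧-zeroʳ (j ≡ᵇ i) = refl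
    pointwise file (_ , nothing) = refl
    pointwise file ((_ , j) , rook) with i ≡ᵇ j
    ... | true  = refl
    ... | false = refl
    pointwise file (_ , file) = refl

  valid-columnPiece : ∀ i {t} → IsPiece t → ∀ cs P →
    valid (((0 , i) , t) ∷ blank cs ++ shift P) ≡ (not (rookInRow P i) ∧ valid P)
  valid-columnPiece i {t} p cs P = begin
    valid (x ∷ blank cs ++ shift P)
      ≡⟨ valid-∷ x (blank cs ++ shift P) ⟩
    not (conflict x x ∨ clash x (blank cs ++ shift P)) ∧ valid (blank cs ++ shift P)
      ≡⟨ cong₂ (λ c v → not c ∧ v) (cong₂ _∨_ (conflict-self x) (trans (clash-blank-++ x cs (shift P)) (clash-shift i p P)))
                                    (trans (valid-blank-++ cs (shift P)) (valid-shift P)) ⟩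
    not (rookInRow P i) ∧ valid P ∎
    where
    open ≡-Reasoning
    x : Cell × Content
    x = ((0 , i) , t)

  piece-cancels-nothing : ∀ i {t} → IsPiece t → ∀ {is} → All (i <_) is → ∀ P →
    All (λ z → cancelledBy (proj₁ z) ((0 , i) , t) ≡ false) (blank (column is) ++ shift P)
  piece-cancels-nothing i p i<is P =
    All.++⁺ (All.map⁺ (All.map⁺ (All.map (below p) i<is))) (All.map⁺ (All.universal (right p) P))
    where
    below : ∀ {t j} → IsPiece t → i < j → cancelledBy (0 , j) ((0 , i) , t) ≡ false
    below {j = j} rook i<j rewrite >⇒<ᵇ≡false i<j | ∧-zeroʳ (j ≡ᵇ i) = refl
    below         file i<j rewrite >⇒<ᵇ≡false i<j = refl
    right : ∀ {t} → IsPiece t → ∀ y → cancelledBy (shiftCell (proj₁ y)) ((0 , i) , t) ≡ false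
    right rook y rewrite ∧-zeroʳ (row (proj₁ y) ≡ᵇ i) = refl
    right file y = refl

  cancelledBy-blankColumn : ∀ i is P → any (cancelledBy (0 , i)) (blank (column is) ++ shift P) ≡ rookInRow P i
  cancelledBy-blankColumn i is P = trans (any-++ _ (blank (column is)) (shift P))
    (cong₂ _∨_ (trans (any-map _ _ (column is)) (any-false (λ _ → refl) (column is))) (trans (any-map _ _ P) (any-cong pointwise P)))
    where
    pointwise : ∀ y → cancelledBy (0 , i) (map₁ shiftCell y) ≡ (isRook (proj₂ y) ∧ (i ≡ᵇ row (proj₁ y)))
    pointwise (_ , nothing) = refl
    pointwise (_ , rook)    = trans (∨-identityʳ _) (∧-identityʳ _)
    pointwise (_ , file)    = refl

  freeRows-∷ : ∀ P i is → freeRows P (i ∷ is) ≡ boolToℕ (not (rookInRow P i)) + freeRows P is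
  freeRows-∷ P i is = length-filterᵇ-∷ (not ∘ rookInRow P) i is

  emptyBoxes-blankColumn : ∀ is P → emptyBoxes (blank (column is) ++ shift P) ≡ freeRows P is + emptyBoxes P
  emptyBoxes-blankColumn []       P = emptyBoxes-shift P
  emptyBoxes-blankColumn (i ∷ is) P = begin
    emptyBoxes (((0 , i) , nothing) ∷ rest)
      ≡⟨ emptyBoxes-blank∷ (0 , i) rest ⟩
    boolToℕ (not (any (cancelledBy (0 , i)) rest)) + emptyBoxes rest
      ≡⟨ cong₂ (λ b e → boolToℕ (not b) + e) (cancelledBy-blankColumn i is P) (emptyBoxes-blankColumn is P) ⟩
    boolToℕ (not (rookInRow P i)) + (freeRows P is + emptyBoxes P)
      ≡⟨ sym (+-assoc (boolToℕ (not (rookInRow P i))) _ _) ⟩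
    (boolToℕ (not (rookInRow P i)) + freeRows P is) + emptyBoxes P
      ≡⟨ cong (_+ emptyBoxes P) (sym (freeRows-∷ P i is)) ⟩
    freeRows P (i ∷ is) + emptyBoxes P ∎
    where
    open ≡-Reasoning
    rest : Placement
    rest = blank (column is) ++ shift P

  emptyBoxes-columnPiece : ∀ i {t} → IsPiece t → ∀ {is} → All (i <_) is → ∀ P →
    emptyBoxes (((0 , i) , t) ∷ blank (column is) ++ shift P) ≡ freeRows P is + emptyBoxes P
  emptyBoxes-columnPiece i p {is} i<is P =
    trans (emptyBoxes-piece∷ _ (blank (column is) ++ shift P) (is-piece p) (piece-cancels-nothing i p i<is P))
          (emptyBoxes-blankColumn is P)
    where
    is-piece : ∀ {t} → IsPiece t → isNothing t ≡ false
    is-piece rook = refl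
    is-piece file = refl

  Apart : Cell → Cell → Set
  Apart x y = sameCell x y ≡ false

  no-rook-in-row : ∀ y P → All (Apart y ∘ proj₁) P → any (conflict (y , rook)) P ≡ false →
    rookInRow P (row y) ≡ false
  no-rook-in-row y []                   []           _  = refl
  no-rook-in-row y ((z , nothing) ∷ P) (_ ∷ apart) nc = no-rook-in-row y P apart nc
  no-rook-in-row y ((z , file)    ∷ P) (_ ∷ apart) nc = no-rook-in-row y P apart nc
  no-rook-in-row y ((z , rook)    ∷ P) (y≠z ∷ apart) nc =
    cong₂ _∨_ (same-row-conflicts (sameCell y z) y≠z (∨-conicalˡ _ _ nc))
              (no-rook-in-row y P apart (∨-conicalʳ _ _ nc))
    where
    same-row-conflicts : ∀ s {r c rest} → s ≡ false → ((not s ∧ (r ∨ c)) ∨ rest) ≡ false → r ≡ false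
    same-row-conflicts false {false} _ _ = refl

  freeRows+rooks : ∀ {is} P → AllPairs _<_ is → valid P ≡ true → AllPairs (Apart on proj₁) P →
    All (λ z → row (proj₁ z) ∈ is) P → freeRows P is + count isRook P ≡ length is
  freeRows+rooks {is} [] _ _ _ _ =
    trans (+-identityʳ _) (cong length (filter-all _ (All.universal (λ _ → _) is)))
  freeRows+rooks ((y , nothing) ∷ P) sorted v (_ ∷ apart) (_ ∷ rows) =
    freeRows+rooks P sorted (valid-∷⁻ (y , nothing) P v) apart rows
  freeRows+rooks ((y , file) ∷ P) sorted v (_ ∷ apart) (_ ∷ rows) =
    freeRows+rooks P sorted (valid-∷⁻ (y , file) P v) apart rows
  freeRows+rooks {is} ((y , rook) ∷ P) sorted v (y-apart ∷ apart) (y-row ∷ rows) = begin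
    freeRows ((y , rook) ∷ P) is + suc (count isRook P)   ≡⟨ +-suc _ _ ⟩
    suc (freeRows ((y , rook) ∷ P) is) + count isRook P   ≡⟨ cong (_+ count isRook P) removed ⟩
    freeRows P is + count isRook P                       ≡⟨ freeRows+rooks P sorted (valid-∷⁻ (y , rook) P v) apart rows ⟩
    length is ∎
    where
    open ≡-Reasoning
    removed : suc (freeRows ((y , rook) ∷ P) is) ≡ freeRows P is
    removed = length-filterᵇ-remove (rookInRow P) sorted y-row
      (no-rook-in-row y P y-apart (valid-∷⇒no-conflict (y , rook) P v))

  cellsFrom-suc : ∀ c B → cellsFrom (suc c) B ≡ map shiftCell (cellsFrom c B)
  cellsFrom-suc c []      = refl
  cellsFrom-suc c (h ∷ B) = trans (cong₂ _++_ (map-∘ (upTo h)) (cellsFrom-suc (suc c) B))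
                                  (sym (map-++ shiftCell (map (c ,_) (upTo h)) (cellsFrom (suc c) B)))

  cells-∷ : ∀ h B → cells (h ∷ B) ≡ column (upTo h) ++ map shiftCell (cells B)
  cells-∷ h B = cong (column (upTo h) ++_) (cellsFrom-suc 0 B)

  cellsFrom-rows : ∀ {h} c B → All (_≤ h) B → All (λ x → row x < h) (cellsFrom c B)
  cellsFrom-rows c []       []            = []
  cellsFrom-rows c (h′ ∷ B) (h′≤h ∷ B≤h) =
    All.++⁺ (All.map⁺ (All.applyUpTo⁺₁ id h′ (λ i<h′ → <-≤-trans i<h′ h′≤h))) (cellsFrom-rows (suc c) B B≤h)

  cellsFrom-cols : ∀ c B → All (λ x → c ≤ col x) (cellsFrom c B)
  cellsFrom-cols c []      = []
  cellsFrom-cols c (h ∷ B) = All.++⁺ (All.map⁺ (All.applyUpTo⁺₂ id h (λ _ → ≤-refl)))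
                                     (All.map (≤-trans (n≤1+n c)) (cellsFrom-cols (suc c) B))

  cellsFrom-apart : ∀ c B → AllPairs Apart (cellsFrom c B)
  cellsFrom-apart c []      = []
  cellsFrom-apart c (h ∷ B) = AllPairs.++⁺
    (AllPairs.map⁺ (AllPairs.applyUpTo⁺₁ id h (λ i<j _ → apart-rows i<j)))
    (cellsFrom-apart (suc c) B)
    (All.map⁺ (All.applyUpTo⁺₂ id h (λ i → All.map (apart-cols i) (cellsFrom-cols (suc c) B))))
    where
    apart-rows : ∀ {i j} → i < j → Apart (c , i) (c , j)
    apart-rows i<j rewrite ≡ᵇ-refl c = <⇒≢ᵇ i<j
    apart-cols : ∀ i {y} → c < col y → Apart (c , i) y
    apart-cols i {y} c<col = cong (_∧ (i ≡ᵇ row y)) (<⇒≢ᵇ c<col)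

  freeRows-board : ∀ h B P → All (_≤ h) B → map proj₁ P ≡ cells B → valid P ≡ true →
    freeRows P (upTo h) ≡ h ∸ count isRook P
  freeRows-board h B P B≤h P-cells v = begin
    freeRows P (upTo h)                               ≡⟨ sym (m+n∸n≡m _ (count isRook P)) ⟩
    (freeRows P (upTo h) + count isRook P) ∸ count isRook P ≡⟨ cong (_∸ count isRook P) counted ⟩
    h ∸ count isRook P                                ∎
    where
    open ≡-Reasoning
    apart : AllPairs (Apart on proj₁) P
    apart = AllPairs.map⁻ (subst (AllPairs Apart) (sym P-cells) (cellsFrom-apart 0 B))
    rows : All (λ z → row (proj₁ z) ∈ upTo h) P
    rows = All.map⁻ (subst (All (λ x → row x ∈ upTo h)) (sym P-cells) (All.map ∈-upTo⁺ (cellsFrom-rows 0 B B≤h)))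
    counted : freeRows P (upTo h) + count isRook P ≡ h
    counted = trans (freeRows+rooks P (AllPairs.applyUpTo⁺₁ id h (λ i<j _ → i<j)) v apart rows) (length-upTo h)

  Ferrers : List ℕ → Set
  Ferrers = AllPairs _≥_

  jumpBoard-suc : ∀ n r → jumpBoard (suc n) r ≡ r * n ∷ jumpBoard n r
  jumpBoard-suc n r = cong (r * n ∷_) (trans (map-applyUpTo suc _ n) (sym (map-applyUpTo id _ n)))

  jumpBoard-≤ : ∀ n r → All (_≤ r * n) (jumpBoard n r)
  jumpBoard-≤ n r = All.map⁺ (All.applyUpTo⁺₂ id n (λ i → *-monoʳ-≤ r (m∸n≤m n (suc i))))

  jumpBoard-ferrers : ∀ n r → Ferrers (jumpBoard n r)
  jumpBoard-ferrers n r = AllPairs.map⁺ (AllPairs.applyUpTo⁺₁ id n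
    (λ i<j _ → *-monoʳ-≤ r (∸-monoʳ-≤ n (s≤s (<⇒≤ i<j)))))

  length-jumpBoard : ∀ n r → length (jumpBoard n r) ≡ n
  length-jumpBoard n r = trans (length-map _ (upTo n)) (length-upTo n)

open Boards

module Indices where

  open import Data.Integer as ℤ using (+_; _⊖_; 1ℤ)
  import Data.Integer.Properties as ℤ
  open import Data.Integer.Solver using (module +-*-Solver)
  open import Data.Nat as ℕ using (ℕ; suc)
  import Data.Nat.Properties as ℕₚ
  import Relation.Binary.PropositionalEquality as ≡

  ⊖+≡ : ∀ x y → (x ⊖ y) ℤ.+ + y ≡.≡ + x
  ⊖+≡ x y = ≡.trans (ℤ.distribˡ-⊖-+-pos y x y) (≡.trans (ℤ.⊖-≥ (ℕₚ.m≤n+m y x)) (≡.cong +_ (ℕₚ.m+n∸n≡m x y)))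

  ⊖-1 : ∀ x y → (x ⊖ y) ℤ.- 1ℤ ≡.≡ x ⊖ suc y
  ⊖-1 x y = ≡.trans (ℤ.distribˡ-⊖-+-neg 0 x y) (≡.cong (λ z → x ⊖ suc z) (ℕₚ.+-identityʳ y))

  ⊖+⊖ : ∀ x y u → (x ⊖ y) ℤ.+ ((y ℕ.+ u) ⊖ x) ≡.≡ + u
  ⊖+⊖ x y u = begin
    (x ⊖ y) ℤ.+ ((y ℕ.+ u) ⊖ x)
      ≡⟨ ≡.cong₂ ℤ._+_ (≡.sym (ℤ.[+m]-[+n]≡m⊖n x y)) (≡.sym (ℤ.[+m]-[+n]≡m⊖n (y ℕ.+ u) x)) ⟩
    (+ x ℤ.- + y) ℤ.+ (+ (y ℕ.+ u) ℤ.- + x)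
      ≡⟨ ≡.cong (λ z → (+ x ℤ.- + y) ℤ.+ (z ℤ.- + x)) (ℤ.pos-+ y u) ⟩
    (+ x ℤ.- + y) ℤ.+ ((+ y ℤ.+ + u) ℤ.- + x)
      ≡⟨ solve 3 (λ x y u → (x :- y) :+ ((y :+ u) :- x) := u) ≡.refl (+ x) (+ y) (+ u) ⟩
    + u ∎
    where open ≡.≡-Reasoning
          open +-*-Solver

  rowIndex : ∀ r n j → (+ r ℤ.* + n) ℤ.- + j ≡.≡ (r ℕ.* n) ⊖ j
  rowIndex r n j = ≡.trans (≡.cong (ℤ._- + j) (≡.sym (ℤ.pos-* r n))) (ℤ.[+m]-[+n]≡m⊖n (r ℕ.* n) j)

  pieceIndex : ∀ r n j k → (+ j ℤ.- (+ r ℤ.- + 1) ℤ.* + n) ℤ.- + k ≡.≡ (j ℕ.+ n) ⊖ (r ℕ.* n ℕ.+ k)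
  pieceIndex r n j k = begin
    (+ j ℤ.- (+ r ℤ.- + 1) ℤ.* + n) ℤ.- + k
      ≡⟨ solve 4 (λ r n j k → (j :- (r :- con (+ 1)) :* n) :- k := (j :+ n) :- (r :* n :+ k))
               ≡.refl (+ r) (+ n) (+ j) (+ k) ⟩
    (+ j ℤ.+ + n) ℤ.- (+ r ℤ.* + n ℤ.+ + k)
      ≡⟨ ≡.cong₂ ℤ._-_ (≡.sym (ℤ.pos-+ j n))
                       (≡.trans (≡.cong (ℤ._+ + k) (≡.sym (ℤ.pos-* r n))) (≡.sym (ℤ.pos-+ (r ℕ.* n) k))) ⟩
    + (j ℕ.+ n) ℤ.- + (r ℕ.* n ℕ.+ k)
      ≡⟨ ℤ.[+m]-[+n]≡m⊖n (j ℕ.+ n) (r ℕ.* n ℕ.+ k) ⟩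
    (j ℕ.+ n) ⊖ (r ℕ.* n ℕ.+ k) ∎
    where open ≡.≡-Reasoning
          open +-*-Solver

open Indices

module Sums {c ℓ : Level} (R : CommutativeRing c ℓ) where

  open import Data.Bool using (Bool; true; false; if_then_else_)
  open import Data.List using (List; []; _∷_; _++_; map; concatMap; foldr; zip; length)
  open import Data.Nat using (suc)
  open import Data.Product using (_,_; proj₁)
  open import Function using (_∘_)
  import Relation.Binary.PropositionalEquality as ≡

  open CommutativeRing R
  open import Relation.Binary.Reasoning.Setoid setoid
  open import Algebra.Properties.CommutativeSemigroup +-commutativeSemigroup using (interchange)

  private
    variable
      a : Level
      A B : Set a

  Σ : (A → Carrier) → List A → Carrier
  Σ f = foldr (λ x acc → f x + acc) 0#

  Σ-cong : {f g : A → Carrier} → (∀ x → f x ≈ g x) → ∀ xs → Σ f xs ≈ Σ g xs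
  Σ-cong f≈g []       = refl
  Σ-cong f≈g (x ∷ xs) = +-cong (f≈g x) (Σ-cong f≈g xs)

  Σ-map : (f : B → Carrier) (g : A → B) (xs : List A) → Σ f (map g xs) ≡.≡ Σ (f ∘ g) xs
  Σ-map f g []       = ≡.refl
  Σ-map f g (x ∷ xs) = ≡.cong (f (g x) +_) (Σ-map f g xs)

  Σ-++ : (f : A → Carrier) (xs ys : List A) → Σ f (xs ++ ys) ≈ Σ f xs + Σ f ys
  Σ-++ f []       ys = sym (+-identityˡ _)
  Σ-++ f (x ∷ xs) ys = trans (+-congˡ (Σ-++ f xs ys)) (sym (+-assoc _ _ _))

  Σ-concatMap : (f : B → Carrier) (g : A → List B) (xs : List A) →
    Σ f (concatMap g xs) ≈ Σ (λ x → Σ f (g x)) xs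
  Σ-concatMap f g []       = refl
  Σ-concatMap f g (x ∷ xs) = trans (Σ-++ f (g x) (concatMap g xs)) (+-congˡ (Σ-concatMap f g xs))

  Σ-0 : (xs : List A) → Σ (λ _ → 0#) xs ≈ 0#
  Σ-0 []       = refl
  Σ-0 (x ∷ xs) = trans (+-identityˡ _) (Σ-0 xs)

  Σ-+ : (f g : A → Carrier) (xs : List A) → Σ (λ x → f x + g x) xs ≈ Σ f xs + Σ g xs
  Σ-+ f g []       = sym (+-identityˡ _)
  Σ-+ f g (x ∷ xs) = trans (+-congˡ (Σ-+ f g xs)) (interchange _ _ _ _)

  Σ-*ˡ : (u : Carrier) (f : A → Carrier) (xs : List A) → Σ (λ x → u * f x) xs ≈ u * Σ f xs
  Σ-*ˡ u f []       = sym (zeroʳ u)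
  Σ-*ˡ u f (x ∷ xs) = trans (+-congˡ (Σ-*ˡ u f xs)) (sym (distribˡ _ _ _))

  Σ-*ʳ : (u : Carrier) (f : A → Carrier) (xs : List A) → Σ (λ x → f x * u) xs ≈ Σ f xs * u
  Σ-*ʳ u f xs = trans (Σ-cong (λ x → *-comm (f x) u) xs) (trans (Σ-*ˡ u f xs) (*-comm u _))

  Σ-filterᵇ : (f : A → Carrier) (p : A → Bool) (xs : List A) →
    Σ f (filterᵇ p xs) ≈ Σ (λ x → if p x then f x else 0#) xs
  Σ-filterᵇ f p []       = refl
  Σ-filterᵇ f p (x ∷ xs) with p x
  ... | true  = +-congˡ (Σ-filterᵇ f p xs)
  ... | false = trans (Σ-filterᵇ f p xs) (sym (+-identityˡ _))

  ΣPl : List Cell → (Placement → Carrier) → Carrier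
  ΣPl []       f = f []
  ΣPl (c ∷ cs) f = ΣPl cs (f ∘ ((c , nothing) ∷_)) + ΣPl cs (f ∘ ((c , rook) ∷_)) + ΣPl cs (f ∘ ((c , file) ∷_))

  Σ-labellings : ∀ cs (f : Placement → Carrier) → Σ f (map (zip cs) (labellings (length cs))) ≈ ΣPl cs f
  Σ-labellings []       f = +-identityʳ (f [])
  Σ-labellings (c ∷ cs) f = begin
    Σ f (map (zip (c ∷ cs)) (labellings (suc (length cs))))
      ≡⟨ Σ-map f (zip (c ∷ cs)) (labellings (suc (length cs))) ⟩
    Σ (f ∘ zip (c ∷ cs)) (labellings (suc (length cs)))
      ≈⟨ Σ-concatMap _ _ L ⟩
    Σ (λ l → g nothing l + (g rook l + (g file l + 0#))) L
      ≈⟨ Σ-cong (λ l → +-congˡ (+-congˡ (+-identityʳ _))) L ⟩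
    Σ (λ l → g nothing l + (g rook l + g file l)) L
      ≈⟨ trans (Σ-+ _ _ L) (trans (+-congˡ (Σ-+ _ _ L)) (sym (+-assoc _ _ _))) ⟩
    Σ (g nothing) L + Σ (g rook) L + Σ (g file) L
      ≈⟨ +-cong (+-cong (labelled nothing) (labelled rook)) (labelled file) ⟩
    ΣPl (c ∷ cs) f ∎
    where
    L : List (List Content)
    L = labellings (length cs)
    g : Content → List Content → Carrier
    g t l = f ((c , t) ∷ zip cs l)
    labelled : ∀ t → Σ (g t) L ≈ ΣPl cs (f ∘ ((c , t) ∷_))
    labelled t = trans (reflexive (≡.sym (Σ-map (f ∘ ((c , t) ∷_)) (zip cs) L))) (Σ-labellings cs _)

  ΣPl-cong : ∀ cs {f g : Placement → Carrier} → (∀ P → map proj₁ P ≡.≡ cs → f P ≈ g P) → ΣPl cs f ≈ ΣPl cs g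
  ΣPl-cong []       f≈g = f≈g [] ≡.refl
  ΣPl-cong (c ∷ cs) {f} {g} f≈g = +-cong (+-cong (on nothing) (on rook)) (on file)
    where
    on : ∀ t → ΣPl cs (f ∘ ((c , t) ∷_)) ≈ ΣPl cs (g ∘ ((c , t) ∷_))
    on t = ΣPl-cong cs (λ P P-cells → f≈g ((c , t) ∷ P) (≡.cong (c ∷_) P-cells))

  ΣPl-+ : ∀ cs (f g : Placement → Carrier) → ΣPl cs (λ P → f P + g P) ≈ ΣPl cs f + ΣPl cs g
  ΣPl-+ []       f g = refl
  ΣPl-+ (c ∷ cs) f g =
    trans (+-cong (+-cong (ΣPl-+ cs _ _) (ΣPl-+ cs _ _)) (ΣPl-+ cs _ _))
          (trans (+-congʳ (interchange _ _ _ _)) (interchange _ _ _ _))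

  ΣPl-*ˡ : ∀ cs (u : Carrier) (f : Placement → Carrier) → ΣPl cs (λ P → u * f P) ≈ u * ΣPl cs f
  ΣPl-*ˡ []       u f = refl
  ΣPl-*ˡ (c ∷ cs) u f =
    trans (+-cong (+-cong (ΣPl-*ˡ cs u _) (ΣPl-*ˡ cs u _)) (ΣPl-*ˡ cs u _))
          (trans (+-congʳ (sym (distribˡ u _ _))) (sym (distribˡ u _ _)))

  ΣPl-0 : ∀ cs → ΣPl cs (λ _ → 0#) ≈ 0#
  ΣPl-0 cs = trans (ΣPl-cong cs (λ _ _ → sym (zeroˡ 0#))) (trans (ΣPl-*ˡ cs 0# (λ _ → 0#)) (zeroˡ _))

  ΣPl-swap : ∀ cs ds (f : Placement → Placement → Carrier) →
    ΣPl cs (λ C → ΣPl ds (f C)) ≈ ΣPl ds (λ P → ΣPl cs (λ C → f C P))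
  ΣPl-swap []       ds f = refl
  ΣPl-swap (c ∷ cs) ds f =
    trans (+-cong (+-cong (ΣPl-swap cs ds _) (ΣPl-swap cs ds _)) (ΣPl-swap cs ds _))
          (trans (+-congʳ (sym (ΣPl-+ ds _ _))) (sym (ΣPl-+ ds _ _)))

  ΣPl-++ : ∀ cs ds (f : Placement → Carrier) → ΣPl (cs ++ ds) f ≈ ΣPl cs (λ C → ΣPl ds (f ∘ (C ++_)))
  ΣPl-++ []       ds f = refl
  ΣPl-++ (c ∷ cs) ds f = +-cong (+-cong (ΣPl-++ cs ds _) (ΣPl-++ cs ds _)) (ΣPl-++ cs ds _)

  ΣPl-shift : ∀ cs (f : Placement → Carrier) → ΣPl (map shiftCell cs) f ≈ ΣPl cs (f ∘ shift)
  ΣPl-shift []       f = refl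
  ΣPl-shift (c ∷ cs) f = +-cong (+-cong (ΣPl-shift cs _) (ΣPl-shift cs _)) (ΣPl-shift cs _)

  ΣPl-blank : ∀ cs (f : Placement → Carrier) → (∀ P → map proj₁ P ≡.≡ cs → hasPiece P ≡.≡ true → f P ≈ 0#) →
    ΣPl cs f ≈ f (blank cs)
  ΣPl-blank []       f vanish = refl
  ΣPl-blank (c ∷ cs) f vanish = begin
    ΣPl cs (f ∘ ((c , nothing) ∷_)) + ΣPl cs (f ∘ ((c , rook) ∷_)) + ΣPl cs (f ∘ ((c , file) ∷_))
      ≈⟨ +-cong (+-cong (ΣPl-blank cs _ (λ P P-cells → vanish _ (≡.cong (c ∷_) P-cells)))
                        (piece-vanishes rook)) (piece-vanishes file) ⟩
    f (blank (c ∷ cs)) + ΣPl cs (λ _ → 0#) + ΣPl cs (λ _ → 0#)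
      ≈⟨ +-cong (+-cong refl (ΣPl-0 cs)) (ΣPl-0 cs) ⟩
    f (blank (c ∷ cs)) + 0# + 0#
      ≈⟨ trans (+-identityʳ _) (+-identityʳ _) ⟩
    f (blank (c ∷ cs)) ∎
    where
    piece-vanishes : ∀ {t} → IsPiece t → ΣPl cs (f ∘ ((c , t) ∷_)) ≈ ΣPl cs (λ _ → 0#)
    piece-vanishes rook = ΣPl-cong cs (λ P P-cells → vanish _ (≡.cong (c ∷_) P-cells) ≡.refl)
    piece-vanishes file = ΣPl-cong cs (λ P P-cells → vanish _ (≡.cong (c ∷_) P-cells) ≡.refl)

module QNumbers {c ℓ : Level} (R : CommutativeRing c ℓ) (q : CommutativeRing.Carrier R) where

  open import Data.Nat as ℕ using (ℕ; zero; suc)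

  open CommutativeRing R hiding (zero)
  open WithRing R using (pow)
  open import Relation.Binary.Reasoning.Setoid setoid
  open import Algebra.Solver.Ring.NaturalCoefficients.Default commutativeSemiring

  [_]q : ℕ → Carrier
  [ zero  ]q = 0#
  [ suc n ]q = [ n ]q + pow q n

  pow-+ : ∀ x m n → pow x (m ℕ.+ n) ≈ pow x m * pow x n
  pow-+ x zero    n = sym (*-identityˡ _)
  pow-+ x (suc m) n = trans (*-congˡ (pow-+ x m n)) (sym (*-assoc _ _ _))

  [suc]q : ∀ n → [ suc n ]q ≈ q * [ n ]q + 1#
  [suc]q zero    = +-cong (sym (zeroʳ q)) refl
  [suc]q (suc n) = begin
    [ suc n ]q + q * pow q n          ≈⟨ +-congʳ ([suc]q n) ⟩
    q * [ n ]q + 1# + q * pow q n     ≈⟨ solve 4 (λ q x y o → q :* x :+ o :+ q :* y := q :* (x :+ y) :+ o) refl q [ n ]q (pow q n) 1# ⟩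
    q * [ suc n ]q + 1#               ∎

module RookNumbers {c ℓ : Level} (R : CommutativeRing c ℓ) (μ ν q : CommutativeRing.Carrier R) where

  open import Data.Bool using (Bool; T; true; false; if_then_else_; _∧_; _∨_; not)
  open import Data.Bool.Properties using (∧-zeroʳ)
  open import Data.Bool.ListAction using (any)
  open import Data.List using (List; []; _∷_; _++_; map; upTo; length)
  open import Data.List.Relation.Unary.All using (All; []; _∷_)
  open import Data.List.Relation.Unary.AllPairs using (AllPairs; []; _∷_)
  import Data.List.Relation.Unary.AllPairs.Properties as AllPairs
  open import Data.Nat as ℕ using (ℕ; zero; suc; _≡ᵇ_; _<_; _∸_; s≤s)
  open import Data.Nat.Properties using (≡ᵇ⇒≡; ≤-trans; n≤1+n; ≤-pred; +-suc; m≤n⇒m∸n≡0)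
  open import Data.Product using (_×_; _,_; proj₁; proj₂)
  open import Function using (_∘_; id)
  import Relation.Binary.PropositionalEquality as ≡

  open CommutativeRing R hiding (zero)
  open WithRing R
  open Relation μ ν q
  open Sums R
  open QNumbers R q
  open import Relation.Binary.Reasoning.Setoid setoid
  open import Algebra.Solver.Ring.NaturalCoefficients.Default commutativeSemiring

  selectWeight : Bool → ℕ → ℕ → ℕ → ℕ → ℕ → Carrier
  selectWeight v r f e a b = if v ∧ (r ≡ᵇ a) ∧ (f ≡ᵇ b) then pow q e else 0#

  -- The weight of P in m_(a,b) when one more piece of kind t, placed in the new column, is counted
  -- among its rooks and files.
  weightWith : Content → ℕ → ℕ → Placement → Carrier
  weightWith t a b P = selectWeight (valid P) (boolToℕ (isRook t) ℕ.+ count isRook P) (boolToℕ (isFile t) ℕ.+ count isFile P)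
                                    (emptyBoxes P) a b

  weight : ℕ → ℕ → Placement → Carrier
  weight = weightWith nothing

  m-ΣPl : ∀ a b B → m a b B ≈ pow μ a * pow ν b * ΣPl (cells B) (weight a b)
  m-ΣPl a b B = *-congˡ (trans (Σ-filterᵇ _ _ (placements B)) (Σ-labellings (cells B) (weight a b)))

  selectWeight-+ : ∀ v r f x e a b → selectWeight v r f (x ℕ.+ e) a b ≈ pow q x * selectWeight v r f e a b
  selectWeight-+ v r f x e a b with v ∧ (r ≡ᵇ a) ∧ (f ≡ᵇ b)
  ... | true  = pow-+ q x e
  ... | false = sym (zeroʳ _)

  selectWeight-unless : ∀ ρ v r f x e a b →
    selectWeight (not ρ ∧ v) r f (x ℕ.+ e) a b ≈ (if ρ then 0# else pow q x) * selectWeight v r f e a b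
  selectWeight-unless true  v r f x e a b = sym (zeroˡ _)
  selectWeight-unless false v r f x e a b = selectWeight-+ v r f x e a b

  weightWith-≡ : ∀ t a b P {v r f e} →
    valid P ≡.≡ v → count isRook P ≡.≡ r → count isFile P ≡.≡ f → emptyBoxes P ≡.≡ e →
    weightWith t a b P ≡.≡ selectWeight v (boolToℕ (isRook t) ℕ.+ r) (boolToℕ (isFile t) ℕ.+ f) e a b
  weightWith-≡ t a b P ≡.refl ≡.refl ≡.refl ≡.refl = ≡.refl

  weightWith-shift : ∀ t a b P → weightWith t a b (shift P) ≡.≡ weightWith t a b P
  weightWith-shift t a b P = weightWith-≡ t a b (shift P) (valid-shift P) (count-shift isRook P) (count-shift isFile P) (emptyBoxes-shift P)

  weight-blank∷ : ∀ a b d P → weight a b ((d , nothing) ∷ P) ≈ pow q (boolToℕ (not (any (cancelledBy d) P))) * weight a b P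
  weight-blank∷ a b d P =
    trans (reflexive (weightWith-≡ nothing a b ((d , nothing) ∷ P) (valid-blank∷ d P) ≡.refl ≡.refl (emptyBoxes-blank∷ d P)))
          (selectWeight-+ (valid P) (count isRook P) (count isFile P) (boolToℕ (not (any (cancelledBy d) P))) (emptyBoxes P) a b)

  weight-columnPiece : ∀ a b i {t} → IsPiece t → ∀ {is} → All (i <_) is → ∀ P →
    weight a b (((0 , i) , t) ∷ blank (column is) ++ shift P)
      ≈ (if rookInRow P i then 0# else pow q (freeRows P is)) * weightWith t a b P
  weight-columnPiece a b i {t} p {is} i<is P = begin
    weight a b placed
      ≡⟨ weightWith-≡ nothing a b placed (valid-columnPiece i p (column is) P) (counted isRook ≡.refl) (counted isFile ≡.refl)
                                    (emptyBoxes-columnPiece i p i<is P) ⟩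
    selectWeight (not (rookInRow P i) ∧ valid P) (boolToℕ (isRook t) ℕ.+ count isRook P) (boolToℕ (isFile t) ℕ.+ count isFile P)
                 (freeRows P is ℕ.+ emptyBoxes P) a b
      ≈⟨ selectWeight-unless (rookInRow P i) (valid P) (boolToℕ (isRook t) ℕ.+ count isRook P)
                             (boolToℕ (isFile t) ℕ.+ count isFile P) (freeRows P is) (emptyBoxes P) a b ⟩
    (if rookInRow P i then 0# else pow q (freeRows P is)) * weightWith t a b P ∎
    where
    placed : Placement
    placed = ((0 , i) , t) ∷ blank (column is) ++ shift P
    counted : ∀ p → p nothing ≡.≡ false → count p placed ≡.≡ boolToℕ (p t) ℕ.+ count p P
    counted p pn = ≡.trans (length-filterᵇ-∷ (p ∘ proj₂) _ _)
      (≡.cong (boolToℕ (p t) ℕ.+_) (≡.trans (count-blank-++ p pn (column is) (shift P)) (count-shift p P)))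

  weightWith-invalid : ∀ t a b P → valid P ≡.≡ false → weightWith t a b P ≡.≡ 0#
  weightWith-invalid t a b P invalid rewrite invalid = ≡.refl

  weight-columnBlank : ∀ a b P i {is} → All (i <_) is → ∀ C → map proj₁ C ≡.≡ column is → ∀ w →
    (if hasPiece C then 1# else w) * weight a b (((0 , i) , nothing) ∷ C ++ shift P)
      ≈ (if hasPiece C then 1# else w * pow q (boolToℕ (not (rookInRow P i)))) * weight a b (C ++ shift P)
  weight-columnBlank a b P i i<is C C-cells w = begin
    (if hasPiece C then 1# else w) * weight a b (((0 , i) , nothing) ∷ C ++ shift P)
      ≈⟨ *-congˡ (weight-blank∷ a b (0 , i) (C ++ shift P)) ⟩
    (if hasPiece C then 1# else w) * (pow q (boolToℕ (not (any (cancelledBy (0 , i)) (C ++ shift P)))) * weight a b (C ++ shift P))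
      ≡⟨ ≡.cong (λ c → (if hasPiece C then 1# else w) * (pow q (boolToℕ (not c)) * weight a b (C ++ shift P))) cancelled ⟩
    (if hasPiece C then 1# else w) * (pow q (boolToℕ (not (hasPiece C ∨ rookInRow P i))) * weight a b (C ++ shift P))
      ≈⟨ factor (hasPiece C) ⟩
    (if hasPiece C then 1# else w * pow q (boolToℕ (not (rookInRow P i)))) * weight a b (C ++ shift P) ∎
    where
    cancelled : any (cancelledBy (0 , i)) (C ++ shift P) ≡.≡ (hasPiece C ∨ rookInRow P i)
    cancelled = ≡.trans (any-++ _ C (shift P))
      (≡.cong₂ _∨_ (cancelledBy-below i C (column-below C i<is C-cells)) (cancelledBy-blankColumn i [] P))
    factor : ∀ h → (if h then 1# else w) * (pow q (boolToℕ (not (h ∨ rookInRow P i))) * weight a b (C ++ shift P))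
                   ≈ (if h then 1# else w * pow q (boolToℕ (not (rookInRow P i)))) * weight a b (C ++ shift P)
    factor true  = *-congˡ (*-identityˡ _)
    factor false = sym (*-assoc _ _ _)

  ΣPl-columnPiece : ∀ a b P i {t} → IsPiece t → ∀ {is} → All (i <_) is →
    ΣPl (column is) (λ C → weight a b (((0 , i) , t) ∷ C ++ shift P))
      ≈ (if rookInRow P i then 0# else pow q (freeRows P is)) * weightWith t a b P
  ΣPl-columnPiece a b P i {t} p {is} i<is =
    trans (ΣPl-blank (column is) _ vanish) (weight-columnPiece a b i p i<is P)
    where
    x : Cell × Content
    x = ((0 , i) , t)
    vanish : ∀ C → map proj₁ C ≡.≡ column is → hasPiece C ≡.≡ true → weight a b (x ∷ C ++ shift P) ≈ 0#
    vanish C C-cells has-piece = reflexive (weightWith-invalid nothing a b (x ∷ C ++ shift P) (clash⇒invalid x (C ++ shift P)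
      (≡.trans (any-++ _ C (shift P)) (≡.cong (_∨ _) (clash-below i p C (column-below C i<is C-cells) has-piece)))))

  -- w is the factor q^(free rows) collected from the empty boxes above; it applies only if
  -- the column below holds no piece, since otherwise those boxes are cancelled.
  column-sum : ∀ a b P is → AllPairs ℕ._<_ is → ∀ w →
    ΣPl (column is) (λ C → (if hasPiece C then 1# else w) * weight a b (C ++ shift P))
      ≈ w * pow q (freeRows P is) * weight a b P + [ freeRows P is ]q * (weightWith rook a b P + weightWith file a b P)
  column-sum a b P [] [] w = begin
    w * weight a b (shift P)      ≡⟨ ≡.cong (w *_) (weightWith-shift nothing a b P) ⟩
    w * weight a b P              ≈⟨ solve 3 (λ w W S → w :* W := w :* con 1 :* W :+ con 0 :* S) refl w (weight a b P) _ ⟩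
    w * 1# * weight a b P + 0# * (weightWith rook a b P + weightWith file a b P) ∎
  column-sum a b P (i ∷ is) (i<is ∷ sorted) w = begin
    ΣPl (column (i ∷ is)) (λ C → (if hasPiece C then 1# else w) * weight a b (C ++ shift P))
      ≈⟨ +-cong (+-cong blank-on-top (piece-on-top rook)) (piece-on-top file) ⟩
    w * pow q (boolToℕ (not ρ)) * pow q fr * W + [ fr ]q * (WR + WF) + onTop * WR + onTop * WF
      ≈⟨ combine ρ ⟩
    w * pow q (boolToℕ (not ρ) ℕ.+ fr) * W + [ boolToℕ (not ρ) ℕ.+ fr ]q * (WR + WF)
      ≡⟨ ≡.cong (λ k → w * pow q k * W + [ k ]q * (WR + WF)) (≡.sym (freeRows-∷ P i is)) ⟩
    w * pow q (freeRows P (i ∷ is)) * W + [ freeRows P (i ∷ is) ]q * (WR + WF) ∎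
    where
    ρ : Bool
    ρ = rookInRow P i
    fr : ℕ
    fr = freeRows P is
    W WR WF onTop : Carrier
    W  = weight a b P
    WR = weightWith rook a b P
    WF = weightWith file a b P
    onTop = if ρ then 0# else pow q fr
    blank-on-top : ΣPl (column is) (λ C → (if hasPiece C then 1# else w) * weight a b (((0 , i) , nothing) ∷ C ++ shift P))
                     ≈ w * pow q (boolToℕ (not ρ)) * pow q fr * W + [ fr ]q * (WR + WF)
    blank-on-top = trans (ΣPl-cong (column is) (λ C C-cells → weight-columnBlank a b P i i<is C C-cells w))
                         (column-sum a b P is sorted (w * pow q (boolToℕ (not ρ))))
    piece-on-top : ∀ {t} → IsPiece t →
      ΣPl (column is) (λ C → 1# * weight a b (((0 , i) , t) ∷ C ++ shift P)) ≈ onTop * weightWith t a b P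
    piece-on-top p = trans (ΣPl-cong (column is) (λ C _ → *-identityˡ _)) (ΣPl-columnPiece a b P i p i<is)
    combine : ∀ ρ → w * pow q (boolToℕ (not ρ)) * pow q fr * W + [ fr ]q * (WR + WF)
                      + (if ρ then 0# else pow q fr) * WR + (if ρ then 0# else pow q fr) * WF
                    ≈ w * pow q (boolToℕ (not ρ) ℕ.+ fr) * W + [ boolToℕ (not ρ) ℕ.+ fr ]q * (WR + WF)
    combine true  = solve 6 (λ w p W B R F → w :* con 1 :* p :* W :+ B :* (R :+ F) :+ con 0 :* R :+ con 0 :* F
                                          := w :* p :* W :+ B :* (R :+ F)) refl w (pow q fr) W [ fr ]q WR WF
    combine false = solve 7 (λ w q p W B R F → w :* (q :* con 1) :* p :* W :+ B :* (R :+ F) :+ p :* R :+ p :* F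
                                          := w :* (q :* p) :* W :+ (B :+ p) :* (R :+ F)) refl w q (pow q fr) W [ fr ]q WR WF

  weight-cong : ∀ a b P {x y} → (valid P ≡.≡ true → count isRook P ≡.≡ a → x ≈ y) → x * weight a b P ≈ y * weight a b P
  weight-cong a b P {x} {y} x≈y with valid P | count isRook P ≡ᵇ a in c≡a
  ... | false | _     = trans (zeroʳ x) (sym (zeroʳ y))
  ... | true  | false = trans (zeroʳ x) (sym (zeroʳ y))
  ... | true  | true  = *-congʳ (x≈y ≡.refl (≡ᵇ⇒≡ _ a (≡.subst T (≡.sym c≡a) _)))

  ΣPl-freeRows : ∀ h B → All (ℕ._≤ h) B → ∀ (g : ℕ → Carrier) a b →
    ΣPl (cells B) (λ P → g (freeRows P (upTo h)) * weight a b P) ≈ g (h ∸ a) * ΣPl (cells B) (weight a b)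
  ΣPl-freeRows h B B≤h g a b = trans (ΣPl-cong (cells B) at-freeRows) (ΣPl-*ˡ (cells B) (g (h ∸ a)) (weight a b))
    where
    at-freeRows : ∀ P → map proj₁ P ≡.≡ cells B → g (freeRows P (upTo h)) * weight a b P ≈ g (h ∸ a) * weight a b P
    at-freeRows P P-cells = weight-cong a b P (λ v c≡a →
      reflexive (≡.cong g (≡.trans (freeRows-board h B P B≤h P-cells v) (≡.cong (h ∸_) c≡a))))

  ΣPl-leftColumn : ∀ h B a b → ΣPl (cells (h ∷ B)) (weight a b)
    ≈ ΣPl (cells B) (λ P → pow q (freeRows P (upTo h)) * weight a b P)
      + (ΣPl (cells B) (λ P → [ freeRows P (upTo h) ]q * weightWith rook a b P)
         + ΣPl (cells B) (λ P → [ freeRows P (upTo h) ]q * weightWith file a b P))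
  ΣPl-leftColumn h B a b = begin
    ΣPl (cells (h ∷ B)) (weight a b)
      ≡⟨ ≡.cong (λ cs → ΣPl cs (weight a b)) (cells-∷ h B) ⟩
    ΣPl (firstColumn ++ map shiftCell (cells B)) (weight a b)
      ≈⟨ ΣPl-++ firstColumn (map shiftCell (cells B)) (weight a b) ⟩
    ΣPl firstColumn (λ C → ΣPl (map shiftCell (cells B)) (λ Q → weight a b (C ++ Q)))
      ≈⟨ ΣPl-cong firstColumn (λ C _ → ΣPl-shift (cells B) (λ Q → weight a b (C ++ Q))) ⟩
    ΣPl firstColumn (λ C → ΣPl (cells B) (λ P → weight a b (C ++ shift P)))
      ≈⟨ ΣPl-swap firstColumn (cells B) (λ C P → weight a b (C ++ shift P)) ⟩
    ΣPl (cells B) (λ P → ΣPl firstColumn (λ C → weight a b (C ++ shift P)))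
      ≈⟨ ΣPl-cong (cells B) (λ P _ → trans (ΣPl-cong firstColumn (λ C _ → sym (unweighted (hasPiece C) _)))
                                             (column-sum a b P (upTo h) upTo-sorted 1#)) ⟩
    ΣPl (cells B) (λ P → 1# * pow q (fr P) * weight a b P + [ fr P ]q * (weightWith rook a b P + weightWith file a b P))
      ≈⟨ ΣPl-cong (cells B) (λ P _ → +-cong (*-congʳ (*-identityˡ _)) (distribˡ _ _ _)) ⟩
    ΣPl (cells B) (λ P → pow q (fr P) * weight a b P + ([ fr P ]q * weightWith rook a b P + [ fr P ]q * weightWith file a b P))
      ≈⟨ trans (ΣPl-+ (cells B) _ _) (+-congˡ (ΣPl-+ (cells B) _ _)) ⟩
    ΣPl (cells B) (λ P → pow q (fr P) * weight a b P)
      + (ΣPl (cells B) (λ P → [ fr P ]q * weightWith rook a b P) + ΣPl (cells B) (λ P → [ fr P ]q * weightWith file a b P)) ∎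
    where
    firstColumn : List Cell
    firstColumn = column (upTo h)
    fr : Placement → ℕ
    fr P = freeRows P (upTo h)
    upTo-sorted : AllPairs ℕ._<_ (upTo h)
    upTo-sorted = AllPairs.applyUpTo⁺₁ id h (λ i<j _ → i<j)
    unweighted : ∀ hp V → (if hp then 1# else 1#) * V ≈ V
    unweighted true  V = *-identityˡ V
    unweighted false V = *-identityˡ V

  rookTerm : ℕ → ℕ → ℕ → List ℕ → Carrier
  rookTerm h zero    b B = 0#
  rookTerm h (suc a) b B = μ * [ h ∸ a ]q * m a b B

  fileTerm : ℕ → ℕ → ℕ → List ℕ → Carrier
  fileTerm h a zero    B = 0#
  fileTerm h a (suc b) B = ν * [ h ∸ a ]q * m a b B

  private
    regroup : ∀ x y u v → x * y * (u * v) ≈ u * (x * y * v)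
    regroup = solve 4 (λ x y u v → x :* y :* (u :* v) := u :* (x :* y :* v)) refl

  ΣPl-withRook : ∀ h B → All (ℕ._≤ h) B → ∀ a b →
    pow μ a * pow ν b * ΣPl (cells B) (λ P → [ freeRows P (upTo h) ]q * weightWith rook a b P) ≈ rookTerm h a b B
  ΣPl-withRook h B B≤h zero    b = trans (*-congˡ (trans (ΣPl-cong (cells B) (λ P _ → no-rook P)) (ΣPl-0 (cells B)))) (zeroʳ _)
    where
    no-rook : ∀ P → [ freeRows P (upTo h) ]q * weightWith rook zero b P ≈ 0#
    no-rook P rewrite ∧-zeroʳ (valid P) = zeroʳ _
  ΣPl-withRook h B B≤h (suc a) b = begin
    μ * pow μ a * pow ν b * ΣPl (cells B) (λ P → [ freeRows P (upTo h) ]q * weight a b P)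
      ≈⟨ *-congˡ (ΣPl-freeRows h B B≤h [_]q a b) ⟩
    μ * pow μ a * pow ν b * ([ h ∸ a ]q * ΣPl (cells B) (weight a b))
      ≈⟨ solve 5 (λ μ x y u v → μ :* x :* y :* (u :* v) := μ :* u :* (x :* y :* v)) refl μ _ _ _ _ ⟩
    μ * [ h ∸ a ]q * (pow μ a * pow ν b * ΣPl (cells B) (weight a b))
      ≈⟨ *-congˡ (sym (m-ΣPl a b B)) ⟩
    μ * [ h ∸ a ]q * m a b B ∎

  ΣPl-withFile : ∀ h B → All (ℕ._≤ h) B → ∀ a b →
    pow μ a * pow ν b * ΣPl (cells B) (λ P → [ freeRows P (upTo h) ]q * weightWith file a b P) ≈ fileTerm h a b B
  ΣPl-withFile h B B≤h a zero    = trans (*-congˡ (trans (ΣPl-cong (cells B) (λ P _ → no-file P)) (ΣPl-0 (cells B)))) (zeroʳ _)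
    where
    no-file : ∀ P → [ freeRows P (upTo h) ]q * weightWith file a zero P ≈ 0#
    no-file P rewrite ∧-zeroʳ (count isRook P ≡ᵇ a) | ∧-zeroʳ (valid P) = zeroʳ _
  ΣPl-withFile h B B≤h a (suc b) = begin
    pow μ a * (ν * pow ν b) * ΣPl (cells B) (λ P → [ freeRows P (upTo h) ]q * weight a b P)
      ≈⟨ *-congˡ (ΣPl-freeRows h B B≤h [_]q a b) ⟩
    pow μ a * (ν * pow ν b) * ([ h ∸ a ]q * ΣPl (cells B) (weight a b))
      ≈⟨ solve 5 (λ ν x y u v → x :* (ν :* y) :* (u :* v) := ν :* u :* (x :* y :* v)) refl ν _ _ _ _ ⟩
    ν * [ h ∸ a ]q * (pow μ a * pow ν b * ΣPl (cells B) (weight a b))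
      ≈⟨ *-congˡ (sym (m-ΣPl a b B)) ⟩
    ν * [ h ∸ a ]q * m a b B ∎

  m-leftColumn : ∀ h B → All (ℕ._≤ h) B → ∀ a b →
    m a b (h ∷ B) ≈ pow q (h ∸ a) * m a b B + (rookTerm h a b B + fileTerm h a b B)
  m-leftColumn h B B≤h a b = begin
    m a b (h ∷ B)
      ≈⟨ m-ΣPl a b (h ∷ B) ⟩
    μν * ΣPl (cells (h ∷ B)) (weight a b)
      ≈⟨ *-congˡ (ΣPl-leftColumn h B a b) ⟩
    μν * (ΣPl (cells B) (λ P → pow q (fr P) * weight a b P)
          + (ΣPl (cells B) (λ P → [ fr P ]q * weightWith rook a b P) + ΣPl (cells B) (λ P → [ fr P ]q * weightWith file a b P)))
      ≈⟨ trans (distribˡ _ _ _) (+-congˡ (distribˡ _ _ _)) ⟩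
    μν * ΣPl (cells B) (λ P → pow q (fr P) * weight a b P)
      + (μν * ΣPl (cells B) (λ P → [ fr P ]q * weightWith rook a b P) + μν * ΣPl (cells B) (λ P → [ fr P ]q * weightWith file a b P))
      ≈⟨ +-cong empty-column (+-cong (ΣPl-withRook h B B≤h a b) (ΣPl-withFile h B B≤h a b)) ⟩
    pow q (h ∸ a) * m a b B + (rookTerm h a b B + fileTerm h a b B) ∎
    where
    μν : Carrier
    μν = pow μ a * pow ν b
    fr : Placement → ℕ
    fr P = freeRows P (upTo h)
    empty-column : μν * ΣPl (cells B) (λ P → pow q (fr P) * weight a b P) ≈ pow q (h ∸ a) * m a b B
    empty-column = trans (*-congˡ (ΣPl-freeRows h B B≤h (pow q) a b))
                         (trans (regroup _ _ _ _) (*-congˡ (sym (m-ΣPl a b B))))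

  sum-of-zeros : ∀ {x y z} → x ≈ 0# → y ≈ 0# → z ≈ 0# → x + (y + z) ≈ 0#
  sum-of-zeros x≈0 y≈0 z≈0 = trans (+-cong x≈0 (+-cong y≈0 z≈0)) (trans (+-identityˡ _) (+-identityˡ 0#))

  private
    scaled-by-[0] : ∀ x {k} y → k ≡.≡ 0 → x * [ k ]q * y ≈ 0#
    scaled-by-[0] x y ≡.refl = trans (*-congʳ (zeroʳ x)) (zeroˡ y)

  m-morePiecesThanColumns : ∀ B → Ferrers B → ∀ a b → length B < a ℕ.+ b → m a b B ≈ 0#
  m-morePiecesThanColumns []      _                 (suc a) b       _    = zeroʳ _
  m-morePiecesThanColumns []      _                 zero    (suc b) _    = zeroʳ _
  m-morePiecesThanColumns (h ∷ B) (B≤h ∷ ferrers) a b len< = trans (m-leftColumn h B B≤h a b)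
    (sum-of-zeros (trans (*-congˡ (m-morePiecesThanColumns B ferrers a b (≤-trans (n≤1+n _) len<))) (zeroʳ _))
                  (rooks a len<) (files b len<))
    where
    rooks : ∀ a → suc (length B) < a ℕ.+ b → rookTerm h a b B ≈ 0#
    rooks zero    _    = refl
    rooks (suc a) len< = trans (*-congˡ (m-morePiecesThanColumns B ferrers a b (≤-pred len<))) (zeroʳ _)
    files : ∀ b → suc (length B) < a ℕ.+ b → fileTerm h a b B ≈ 0#
    files zero    _    = refl
    files (suc b) len< = trans (*-congˡ (m-morePiecesThanColumns B ferrers a b
      (≤-pred (≡.subst (suc (length B) <_) (+-suc a b) len<)))) (zeroʳ _)

  m-moreRooksThanRows : ∀ B → Ferrers B → ∀ {h} → All (ℕ._≤ h) B → ∀ a b → h < a → m a b B ≈ 0#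
  m-moreRooksThanRows []       _                _            (suc a) b _         = zeroʳ _
  m-moreRooksThanRows (h′ ∷ B) (B≤h′ ∷ ferrers) (h′≤h ∷ B≤h) (suc a) b (s≤s h≤a) =
    trans (m-leftColumn h′ B B≤h′ (suc a) b)
      (sum-of-zeros (trans (*-congˡ (m-moreRooksThanRows B ferrers B≤h (suc a) b (s≤s h≤a))) (zeroʳ _))
                    (scaled-by-[0] μ _ (m≤n⇒m∸n≡0 (≤-trans h′≤h h≤a))) (files b))
    where
    files : ∀ b → fileTerm h′ (suc a) b B ≈ 0#
    files zero    = refl
    files (suc b) = scaled-by-[0] ν _ (m≤n⇒m∸n≡0 (≤-trans h′≤h (≤-trans h≤a (n≤1+n a))))

module NormalOrdering {c ℓ : Level} (R : CommutativeRing c ℓ) (μ ν q : CommutativeRing.Carrier R) where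

  open import Data.Bool using (Bool; T; true; false; if_then_else_; _∧_)
  open import Data.Bool.Properties using (∧-zeroʳ)
  open import Data.List using (List; []; _∷_; _++_; map; replicate)
  open import Data.List.Properties using (++-assoc)
  open import Data.Nat as ℕ using (ℕ; zero; suc; pred; _≡ᵇ_; _<_; s≤s)
  open import Data.Nat.Properties using (≡ᵇ⇒≡)
  open import Data.Product using (_,_; proj₁; proj₂)
  import Relation.Binary.PropositionalEquality as ≡

  open CommutativeRing R hiding (zero)
  open WithRing R
  open Relation μ ν q
  open Sums R
  open QNumbers R q
  open import Relation.Binary.Reasoning.Setoid setoid
  open import Algebra.Solver.Ring.NaturalCoefficients.Default commutativeSemiring

  when : Bool → Carrier → Carrier
  when b x = if b then x else 0#

  when-*ˡ : ∀ b x y → x * when b y ≈ when b (x * y)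
  when-*ˡ true  x y = refl
  when-*ˡ false x y = zeroʳ x

  when-*ʳ : ∀ b x y → when b x * y ≈ when b (x * y)
  when-*ʳ true  x y = refl
  when-*ʳ false x y = zeroˡ y

  when-*0 : ∀ b x → when b (x * 0#) ≈ 0#
  when-*0 true  x = zeroʳ x
  when-*0 false x = refl

  coeffSum : (ℕ → ℕ → Bool) → List Term → Carrier
  coeffSum selected = Σ (λ t → when (selected (proj₁ (proj₂ t)) (proj₂ (proj₂ t))) (proj₁ t))

  coeff-coeffSum : ∀ j k L → coeff j k L ≈ coeffSum (λ a b → (a ≡ᵇ j) ∧ (b ≡ᵇ k)) L
  coeff-coeffSum j k []              = refl
  coeff-coeffSum j k ((d , a , b) ∷ L) with (a ≡ᵇ j) ∧ (b ≡ᵇ k)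
  ... | true  = +-congˡ (coeff-coeffSum j k L)
  ... | false = trans (coeff-coeffSum j k L) (sym (+-identityˡ _))

  coeffSum-XYpow : ∀ j selected → coeffSum selected (XYpow j)
    ≈ when (selected j 1) (pow q j) + (when (selected (pred j) 0) (μ * [ j ]q) + when (selected j 0) (ν * [ j ]q))
  coeffSum-XYpow zero    selected = +-congˡ (sym (trans (+-cong (when-*0 _ μ) (when-*0 _ ν)) (+-identityʳ _)))
  coeffSum-XYpow (suc j) selected = begin
    coeffSum selected (map _ (XYpow j) ++ (μ , j , 0) ∷ (ν , suc j , 0) ∷ [])
      ≈⟨ Σ-++ _ (map _ (XYpow j)) _ ⟩
    coeffSum selected (map _ (XYpow j)) + (when (selected j 0) μ + (when (selected (suc j) 0) ν + 0#))
      ≈⟨ +-congʳ (trans (reflexive (Σ-map _ _ (XYpow j)))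
                 (trans (Σ-cong (λ t → sym (when-*ˡ _ q _)) (XYpow j)) (Σ-*ˡ q _ (XYpow j)))) ⟩
    q * coeffSum shifted (XYpow j) + (when (selected j 0) μ + (when (selected (suc j) 0) ν + 0#))
      ≈⟨ +-congʳ (*-congˡ (trans (coeffSum-XYpow j shifted) (+-congˡ (+-congʳ (pred-fix j))))) ⟩
    q * (when (selected (suc j) 1) (pow q j) + (when (selected j 0) (μ * [ j ]q) + when (selected (suc j) 0) (ν * [ j ]q)))
      + (when (selected j 0) μ + (when (selected (suc j) 0) ν + 0#))
      ≈⟨ solve 6 (λ q x y z u v → q :* (x :+ (y :+ z)) :+ (u :+ (v :+ con 0))
                                  := q :* x :+ ((q :* y :+ u) :+ (q :* z :+ v))) refl q _ _ _ _ _ ⟩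
    q * when (selected (suc j) 1) (pow q j) + ((q * when (selected j 0) (μ * [ j ]q) + when (selected j 0) μ)
                                              + (q * when (selected (suc j) 0) (ν * [ j ]q) + when (selected (suc j) 0) ν))
      ≈⟨ +-cong (when-*ˡ _ q _) (+-cong (step μ) (step ν)) ⟩
    when (selected (suc j) 1) (pow q (suc j)) + (when (selected j 0) (μ * [ suc j ]q) + when (selected (suc j) 0) (ν * [ suc j ]q)) ∎
    where
    shifted : ℕ → ℕ → Bool
    shifted a b = selected (suc a) b
    pred-fix : ∀ j → when (shifted (pred j) 0) (μ * [ j ]q) ≈ when (selected j 0) (μ * [ j ]q)
    pred-fix zero    = trans (when-*0 _ μ) (sym (when-*0 _ μ))
    pred-fix (suc j) = refl
    step : ∀ x {b} → q * when b (x * [ j ]q) + when b x ≈ when b (x * [ suc j ]q)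
    step x {true}  = trans (solve 3 (λ q x y → q :* (x :* y) :+ x := x :* (q :* y :+ con 1)) refl q x [ j ]q)
                           (*-congˡ (sym ([suc]q j)))
    step x {false} = trans (+-identityʳ _) (zeroʳ q)

  coeff⁻ : ℕ → ℕ → List Term → Carrier
  coeff⁻ j zero    L = 0#
  coeff⁻ j (suc k) L = coeff j k L

  coeff⁻-coeffSum : ∀ j k L → coeff⁻ j k L ≈ coeffSum (λ a b → (a ≡ᵇ j) ∧ (suc b ≡ᵇ k)) L
  coeff⁻-coeffSum j zero    L = sym (trans (Σ-cong (λ t → reflexive (≡.cong (λ c → when c (proj₁ t)) (∧-zeroʳ _))) L) (Σ-0 L))
  coeff⁻-coeffSum j (suc k) L = coeff-coeffSum j k L

  -- G stands for the pattern-matching lambda in the definition of normal, which cannot be named.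
  coeffSum-map : ∀ selected (G : Term → Term) d b →
    (∀ u → G u ≡.≡ (proj₁ u * d , proj₁ (proj₂ u) , proj₂ (proj₂ u) ℕ.+ b)) →
    ∀ L → coeffSum selected (map G L) ≈ coeffSum (λ x y → selected x (y ℕ.+ b)) L * d
  coeffSum-map selected G d b G-def L = begin
    coeffSum selected (map G L)
      ≡⟨ Σ-map _ G L ⟩
    Σ (λ u → when (selected (proj₁ (proj₂ (G u))) (proj₂ (proj₂ (G u)))) (proj₁ (G u))) L
      ≈⟨ Σ-cong (λ u → trans (reflexive (≡.cong (λ t → when (selected (proj₁ (proj₂ t)) (proj₂ (proj₂ t))) (proj₁ t))
                                                (G-def u)))
                              (sym (when-*ʳ _ _ d))) L ⟩
    Σ (λ u → when (selected (proj₁ (proj₂ u)) (proj₂ (proj₂ u) ℕ.+ b)) (proj₁ u) * d) L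
      ≈⟨ Σ-*ʳ d _ L ⟩
    coeffSum (λ x y → selected x (y ℕ.+ b)) L * d ∎

  when-≡ᵇ : ∀ a j c (f : ℕ → Carrier) d → when ((a ≡ᵇ j) ∧ c) (f a) * d ≈ f j * when ((a ≡ᵇ j) ∧ c) d
  when-≡ᵇ a j c f d with a ≡ᵇ j in a≡j | c
  ... | false | _     = trans (zeroˡ d) (sym (zeroʳ _))
  ... | true  | false = trans (zeroˡ d) (sym (zeroʳ _))
  ... | true  | true  rewrite ≡ᵇ⇒≡ a j (≡.subst T (≡.sym a≡j) _) = refl

  coeffSum-X-term : ∀ j k d a b (G : Term → Term) →
    (∀ u → G u ≡.≡ (proj₁ u * d , proj₁ (proj₂ u) , proj₂ (proj₂ u) ℕ.+ b)) →
    coeffSum (λ x y → (x ≡ᵇ j) ∧ (y ≡ᵇ k)) (map G (XYpow a))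
      ≈ pow q j * when ((a ≡ᵇ j) ∧ (suc b ≡ᵇ k)) d
        + (μ * [ suc j ]q * when ((a ≡ᵇ suc j) ∧ (b ≡ᵇ k)) d + ν * [ j ]q * when ((a ≡ᵇ j) ∧ (b ≡ᵇ k)) d)
  coeffSum-X-term j k d a b G G-def = begin
    coeffSum sel (map G (XYpow a))
      ≈⟨ coeffSum-map sel G d b G-def (XYpow a) ⟩
    coeffSum (λ x y → sel x (y ℕ.+ b)) (XYpow a) * d
      ≈⟨ *-congʳ (coeffSum-XYpow a _) ⟩
    (when (sel a (suc b)) (pow q a) + (when (sel (pred a) b) (μ * [ a ]q) + when (sel a b) (ν * [ a ]q))) * d
      ≈⟨ trans (distribʳ _ _ _) (+-congˡ (distribʳ _ _ _)) ⟩
    when (sel a (suc b)) (pow q a) * d + (when (sel (pred a) b) (μ * [ a ]q) * d + when (sel a b) (ν * [ a ]q) * d)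
      ≈⟨ +-cong (when-≡ᵇ a j _ (pow q) d) (+-cong (μ-term a) (when-≡ᵇ a j _ (λ x → ν * [ x ]q) d)) ⟩
    pow q j * when ((a ≡ᵇ j) ∧ (suc b ≡ᵇ k)) d
      + (μ * [ suc j ]q * when ((a ≡ᵇ suc j) ∧ (b ≡ᵇ k)) d + ν * [ j ]q * when ((a ≡ᵇ j) ∧ (b ≡ᵇ k)) d) ∎
    where
    sel : ℕ → ℕ → Bool
    sel x y = (x ≡ᵇ j) ∧ (y ≡ᵇ k)
    μ-term : ∀ a → when (sel (pred a) b) (μ * [ a ]q) * d ≈ μ * [ suc j ]q * when ((a ≡ᵇ suc j) ∧ (b ≡ᵇ k)) d
    μ-term zero    = trans (*-congʳ (when-*0 _ μ)) (trans (zeroˡ d) (sym (zeroʳ _)))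
    μ-term (suc a) = when-≡ᵇ a j (b ≡ᵇ k) (λ x → μ * [ suc x ]q) d

  coeff-normal-X : ∀ j k w → coeff j k (normal (X ∷ w))
    ≈ pow q j * coeff⁻ j k (normal w) + (μ * [ suc j ]q * coeff (suc j) k (normal w) + ν * [ j ]q * coeff j k (normal w))
  coeff-normal-X j k w = begin
    coeff j k (normal (X ∷ w))
      ≈⟨ coeff-coeffSum j k (normal (X ∷ w)) ⟩
    coeffSum (λ x y → (x ≡ᵇ j) ∧ (y ≡ᵇ k)) (normal (X ∷ w))
      ≈⟨ Σ-concatMap _ _ (normal w) ⟩
    Σ _ (normal w)
      ≈⟨ Σ-cong (λ { (d , a , b) → coeffSum-X-term j k d a b _ (λ _ → ≡.refl) }) (normal w) ⟩
    Σ (λ t → pow q j * f₁ t + (μ * [ suc j ]q * f₂ t + ν * [ j ]q * f₃ t)) (normal w)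
      ≈⟨ trans (Σ-+ _ _ (normal w)) (+-cong (Σ-*ˡ _ _ (normal w))
               (trans (Σ-+ _ _ (normal w)) (+-cong (Σ-*ˡ _ _ (normal w)) (Σ-*ˡ _ _ (normal w))))) ⟩
    pow q j * Σ f₁ (normal w) + (μ * [ suc j ]q * Σ f₂ (normal w) + ν * [ j ]q * Σ f₃ (normal w))
      ≈⟨ +-cong (*-congˡ (sym (coeff⁻-coeffSum j k (normal w))))
                (+-cong (*-congˡ (sym (coeff-coeffSum (suc j) k (normal w)))) (*-congˡ (sym (coeff-coeffSum j k (normal w))))) ⟩
    pow q j * coeff⁻ j k (normal w) + (μ * [ suc j ]q * coeff (suc j) k (normal w) + ν * [ j ]q * coeff j k (normal w)) ∎
    where
    f₁ f₂ f₃ : Term → Carrier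
    f₁ (d , a , b) = when ((a ≡ᵇ j) ∧ (suc b ≡ᵇ k)) d
    f₂ (d , a , b) = when ((a ≡ᵇ suc j) ∧ (b ≡ᵇ k)) d
    f₃ (d , a , b) = when ((a ≡ᵇ j) ∧ (b ≡ᵇ k)) d

  coeff-normal-Y : ∀ j k w → coeff (suc j) k (normal (Y ∷ w)) ≈ coeff j k (normal w)
  coeff-normal-Y j k w = trans (coeff-coeffSum (suc j) k (normal (Y ∷ w)))
    (trans (reflexive (Σ-map _ _ (normal w))) (sym (coeff-coeffSum j k (normal w))))

  coeff-normal-Y₀ : ∀ k w → coeff 0 k (normal (Y ∷ w)) ≈ 0#
  coeff-normal-Y₀ k w = trans (coeff-coeffSum 0 k (normal (Y ∷ w)))
    (trans (reflexive (Σ-map _ _ (normal w))) (Σ-0 (normal w)))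

  coeff-normal-Yʳ : ∀ r j k w → coeff (r ℕ.+ j) k (normal (replicate r Y ++ w)) ≈ coeff j k (normal w)
  coeff-normal-Yʳ zero    j k w = refl
  coeff-normal-Yʳ (suc r) j k w = trans (coeff-normal-Y (r ℕ.+ j) k (replicate r Y ++ w)) (coeff-normal-Yʳ r j k w)

  coeff-normal-Yʳ-< : ∀ r j k w → j < r → coeff j k (normal (replicate r Y ++ w)) ≈ 0#
  coeff-normal-Yʳ-< (suc r) zero    k w _         = coeff-normal-Y₀ k (replicate r Y ++ w)
  coeff-normal-Yʳ-< (suc r) (suc j) k w (s≤s j<r) =
    trans (coeff-normal-Y j k (replicate r Y ++ w)) (coeff-normal-Yʳ-< r j k w j<r)

  S-suc : ∀ r n j k → S r (suc n) (r ℕ.+ j) k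
    ≈ pow q j * coeff⁻ j k (normal (wordYrX n r)) + (μ * [ suc j ]q * S r n (suc j) k + ν * [ j ]q * S r n j k)
  S-suc r n j k = trans (reflexive (≡.cong (λ w → coeff (r ℕ.+ j) k (normal w)) (++-assoc (replicate r Y) (X ∷ []) (wordYrX n r))))
                        (trans (coeff-normal-Yʳ r j k (X ∷ wordYrX n r)) (coeff-normal-X j k (wordYrX n r)))

  S-suc-< : ∀ r n j k → j < r → S r (suc n) j k ≈ 0#
  S-suc-< r n j k j<r = trans (reflexive (≡.cong (λ w → coeff j k (normal w)) (++-assoc (replicate r Y) (X ∷ []) (wordYrX n r))))
                              (coeff-normal-Yʳ-< r j k (X ∷ wordYrX n r) j<r)

module Recursion {c ℓ : Level} (R : CommutativeRing c ℓ) (μ ν q : CommutativeRing.Carrier R) where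

  open import Data.Integer as ℤ using (ℤ; +_; -[1+_]; _⊖_; 1ℤ)
  import Data.Integer.Properties as ℤ
  open import Data.List using ([]; _∷_; length)
  open import Data.List.Relation.Unary.All using (All; _∷_)
  open import Data.Nat as ℕ using (ℕ; zero; suc; _∸_; _<_; _≤_; _<?_)
  import Data.Nat.Properties as ℕₚ
  open import Data.Product using (_,_)
  open import Relation.Nullary using (yes; no)
  import Relation.Binary.PropositionalEquality as ≡

  open CommutativeRing R hiding (zero)
  open WithRing R
  open Relation μ ν q
  open QNumbers R q
  open RookNumbers R μ ν q
  open NormalOrdering R μ ν q
  open import Relation.Binary.Reasoning.Setoid setoid

  mℤ-leftColumn : ∀ h B → All (_≤ h) B → ∀ j a b → a ℤ.+ + j ≡.≡ + h →
    mℤ a b (h ∷ B) ≈ pow q j * mℤ a b B + (μ * [ suc j ]q * mℤ (a ℤ.- 1ℤ) b B + ν * [ j ]q * mℤ a (b ℤ.- 1ℤ) B)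
  mℤ-leftColumn h B B≤h j -[1+ _ ] b        _ = sym (sum-of-zeros (zeroʳ _) (zeroʳ _) (zeroʳ _))
  mℤ-leftColumn h B B≤h j (+ a)    -[1+ n ] _ =
    sym (sum-of-zeros (zeroʳ _) (trans (*-congˡ (mℤ-negʳ (a ⊖ 1) n)) (zeroʳ _)) (zeroʳ _))
    where
    mℤ-negʳ : ∀ x n → mℤ x -[1+ n ] B ≈ 0#
    mℤ-negʳ (+ _)    n = refl
    mℤ-negʳ -[1+ _ ] n = refl
  mℤ-leftColumn h B B≤h j (+ a)    (+ b)    a+j≡h = trans (m-leftColumn h B B≤h a b)
    (+-cong (*-congʳ (reflexive (≡.cong (pow q) (h∸a≡j)))) (+-cong (rooks a a+j≡h) (files b)))
    where
    h∸a≡j : h ∸ a ≡.≡ j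
    h∸a≡j = ≡.trans (≡.cong (_∸ a) (≡.sym (ℤ.+-injective a+j≡h))) (ℕₚ.m+n∸m≡n a j)
    rooks : ∀ a → + a ℤ.+ + j ≡.≡ + h → rookTerm h a b B ≈ μ * [ suc j ]q * mℤ (+ a ℤ.- 1ℤ) (+ b) B
    rooks zero    _     = sym (zeroʳ _)
    rooks (suc a) a+j≡h = *-congʳ (*-congˡ (reflexive (≡.cong [_]q
      (≡.trans (≡.cong (_∸ a) (≡.sym (≡.trans (ℕₚ.+-suc a j) (ℤ.+-injective a+j≡h)))) (ℕₚ.m+n∸m≡n a (suc j))))))
    files : ∀ b → fileTerm h a b B ≈ ν * [ j ]q * mℤ (+ a) (+ b ℤ.- 1ℤ) B
    files zero    = sym (zeroʳ _)
    files (suc b) = *-congʳ (*-congˡ (reflexive (≡.cong [_]q h∸a≡j)))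

  mℤ-morePiecesThanColumns : ∀ B → Ferrers B → ∀ a b → a ℤ.+ b ≡.≡ + suc (length B) → mℤ a b B ≈ 0#
  mℤ-morePiecesThanColumns B ferrers -[1+ _ ] b        _ = refl
  mℤ-morePiecesThanColumns B ferrers (+ a)    -[1+ _ ] _ = refl
  mℤ-morePiecesThanColumns B ferrers (+ a)    (+ b)    a+b≡ =
    m-morePiecesThanColumns B ferrers a b (ℕₚ.≤-reflexive (≡.sym (ℤ.+-injective a+b≡)))

  mℤ-moreRooksThanRows : ∀ B → Ferrers B → ∀ {h} → All (_≤ h) B → ∀ x y z → h ℕ.+ y < x → mℤ (x ⊖ y) z B ≈ 0#
  mℤ-moreRooksThanRows B ferrers {h} B≤h x y z h+y<x rewrite ℤ.⊖-≥ (ℕₚ.m+n≤o⇒n≤o h (ℕₚ.<⇒≤ h+y<x)) with z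
  ... | -[1+ _ ] = refl
  ... | + b      = m-moreRooksThanRows B ferrers B≤h (x ∸ y) b (ℕₚ.m+n≤o⇒m≤o∸n (suc h) h+y<x)

  -- The right-hand side of the theorem, with its indices rn - j and j - (r-1)n - k written with _⊖_.
  mJump : ℕ → ℕ → ℕ → ℕ → Carrier
  mJump r n j k = mℤ ((r ℕ.* n) ⊖ j) ((j ℕ.+ n) ⊖ (r ℕ.* n ℕ.+ k)) (jumpBoard n r)

  mJump⁻ : ℕ → ℕ → ℕ → ℕ → Carrier
  mJump⁻ r n j zero    = 0#
  mJump⁻ r n j (suc k) = mJump r n j k

  mJump-suc : ∀ r n j k → mJump r (suc n) (r ℕ.+ j) k
    ≈ pow q j * mJump⁻ r n j k + (μ * [ suc j ]q * mJump r n (suc j) k + ν * [ j ]q * mJump r n j k)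
  mJump-suc r n j k = begin
    mJump r (suc n) (r ℕ.+ j) k
      ≡⟨ ≡.cong₂ (λ a b → mℤ a b (jumpBoard (suc n) r)) rows-index pieces-index ⟩
    mℤ (H ⊖ j) b (jumpBoard (suc n) r)
      ≡⟨ ≡.cong (mℤ (H ⊖ j) b) (jumpBoard-suc n r) ⟩
    mℤ (H ⊖ j) b (H ∷ jumpBoard n r)
      ≈⟨ mℤ-leftColumn H (jumpBoard n r) (jumpBoard-≤ n r) j (H ⊖ j) b (⊖+≡ H j) ⟩
    pow q j * mℤ (H ⊖ j) b (jumpBoard n r)
      + (μ * [ suc j ]q * mℤ ((H ⊖ j) ℤ.- 1ℤ) b (jumpBoard n r) + ν * [ j ]q * mℤ (H ⊖ j) (b ℤ.- 1ℤ) (jumpBoard n r))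
      ≈⟨ +-cong (*-congˡ (no-file k))
                (+-cong (*-congˡ (reflexive (≡.cong (λ a → mℤ a b (jumpBoard n r)) (⊖-1 H j))))
                        (*-congˡ (reflexive (≡.cong (λ b → mℤ (H ⊖ j) b (jumpBoard n r)) one-file-less)))) ⟩
    pow q j * mJump⁻ r n j k + (μ * [ suc j ]q * mJump r n (suc j) k + ν * [ j ]q * mJump r n j k) ∎
    where
    H : ℕ
    H = r ℕ.* n
    b : ℤ
    b = suc (j ℕ.+ n) ⊖ (H ℕ.+ k)
    rows-index : r ℕ.* suc n ⊖ (r ℕ.+ j) ≡.≡ H ⊖ j
    rows-index = ≡.trans (≡.cong (_⊖ (r ℕ.+ j)) (ℕₚ.*-suc r n)) (ℤ.+-cancelˡ-⊖ r H j)
    pieces-index : (r ℕ.+ j ℕ.+ suc n) ⊖ (r ℕ.* suc n ℕ.+ k) ≡.≡ b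
    pieces-index = ≡.trans (≡.cong₂ _⊖_ (≡.trans (ℕₚ.+-assoc r j (suc n)) (≡.cong (r ℕ.+_) (ℕₚ.+-suc j n)))
                                         (≡.trans (≡.cong (ℕ._+ k) (ℕₚ.*-suc r n)) (ℕₚ.+-assoc r H k)))
                           (ℤ.+-cancelˡ-⊖ r (suc (j ℕ.+ n)) (H ℕ.+ k))
    one-file-less : b ℤ.- 1ℤ ≡.≡ (j ℕ.+ n) ⊖ (H ℕ.+ k)
    one-file-less = ≡.trans (⊖-1 (suc (j ℕ.+ n)) (H ℕ.+ k)) (ℤ.[1+m]⊖[1+n]≡m⊖n (j ℕ.+ n) (H ℕ.+ k))
    no-file : ∀ k → mℤ (H ⊖ j) (suc (j ℕ.+ n) ⊖ (H ℕ.+ k)) (jumpBoard n r) ≈ mJump⁻ r n j k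
    no-file zero    = mℤ-morePiecesThanColumns (jumpBoard n r) (jumpBoard-ferrers n r) (H ⊖ j) (suc (j ℕ.+ n) ⊖ (H ℕ.+ 0))
      (≡.trans (≡.cong₂ (λ x y → (H ⊖ j) ℤ.+ (x ⊖ y)) (≡.sym (ℕₚ.+-suc j n)) (ℕₚ.+-identityʳ H))
               (≡.trans (⊖+⊖ H j (suc n)) (≡.cong (λ l → + suc l) (≡.sym (length-jumpBoard n r)))))
    no-file (suc k) = reflexive (≡.cong (λ y → mℤ (H ⊖ j) y (jumpBoard n r))
      (≡.trans (≡.cong (suc (j ℕ.+ n) ⊖_) (ℕₚ.+-suc H k)) (ℤ.[1+m]⊖[1+n]≡m⊖n (j ℕ.+ n) (H ℕ.+ k))))

  mJump-suc-< : ∀ r n j k → j < r → mJump r (suc n) j k ≈ 0#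
  mJump-suc-< r n j k j<r = mℤ-moreRooksThanRows (jumpBoard (suc n) r) (jumpBoard-ferrers (suc n) r)
    (≡.subst (All (_≤ r ℕ.* n)) (≡.sym (jumpBoard-suc n r)) (ℕₚ.≤-refl ∷ jumpBoard-≤ n r)) (r ℕ.* suc n) j _
    (≡.subst (r ℕ.* n ℕ.+ j <_) (≡.trans (ℕₚ.+-comm (r ℕ.* n) r) (≡.sym (ℕₚ.*-suc r n)))
             (ℕₚ.+-monoʳ-< (r ℕ.* n) j<r))

  S≈mJump : ∀ r n j k → S r n j k ≈ mJump r n j k
  S≈mJump r zero j k rewrite ℕₚ.*-zeroʳ r | ℕₚ.+-identityʳ j = base j k
    where
    base : ∀ j k → coeff j k ((1# , 0 , 0) ∷ []) ≈ mℤ (0 ⊖ j) (j ⊖ k) []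
    base zero    zero    = sym (trans (*-congʳ (*-identityˡ 1#)) (*-identityˡ _))
    base zero    (suc k) = refl
    base (suc j) k       = refl
  S≈mJump r (suc n) j k with j <? r
  ... | yes j<r = trans (S-suc-< r n j k j<r) (sym (mJump-suc-< r n j k j<r))
  ... | no  j≮r =
    ≡.subst (λ j → S r (suc n) j k ≈ mJump r (suc n) j k) (ℕₚ.m+[n∸m]≡n (ℕₚ.≮⇒≥ j≮r)) (step (j ∸ r))
    where
    step : ∀ j → S r (suc n) (r ℕ.+ j) k ≈ mJump r (suc n) (r ℕ.+ j) k
    step j = begin
      S r (suc n) (r ℕ.+ j) k
        ≈⟨ S-suc r n j k ⟩
      pow q j * coeff⁻ j k (normal (wordYrX n r)) + (μ * [ suc j ]q * S r n (suc j) k + ν * [ j ]q * S r n j k)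
        ≈⟨ +-cong (*-congˡ (ih⁻ k)) (+-cong (*-congˡ (S≈mJump r n (suc j) k)) (*-congˡ (S≈mJump r n j k))) ⟩
      pow q j * mJump⁻ r n j k + (μ * [ suc j ]q * mJump r n (suc j) k + ν * [ j ]q * mJump r n j k)
        ≈⟨ sym (mJump-suc r n j k) ⟩
      mJump r (suc n) (r ℕ.+ j) k ∎
      where
      ih⁻ : ∀ k → coeff⁻ j k (normal (wordYrX n r)) ≈ mJump⁻ r n j k
      ih⁻ zero    = refl
      ih⁻ (suc k) = S≈mJump r n j k

open Recursion
open import Data.Nat using (ℕ; _≤_)
open import Data.Integer using (+_; _-_; _*_)
import Relation.Binary.PropositionalEquality as ≡

-- The identity holds for all j and k.
proposition2p16 : {c ℓ : Level} (R : CommutativeRing c ℓ) →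
    (μ ν q : CommutativeRing.Carrier R) (r n j k : ℕ) → k ≤ j →
    CommutativeRing._≈_ R
      (WithRing.Relation.S R μ ν q r n j k)
      (WithRing.Relation.mℤ R μ ν q ((+ r * + n) - + j) ((+ j - (+ r - + 1) * + n) - + k) (jumpBoard n r))
proposition2p16 R μ ν q r n j k _ =
  trans (S≈mJump R μ ν q r n j k)
        (reflexive (≡.cong₂ (λ a b → mℤ a b (jumpBoard n r)) (≡.sym (rowIndex r n j)) (≡.sym (pieceIndex r n j k))))
  where
  open CommutativeRing R using (trans; reflexive)
  open WithRing.Relation R μ ν q using (mℤ)
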